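{- Let $\Gamma$ be a finite link-regular simplicial graph with maximum clique size $d$, with $\mathcal{G}_m(z)$ ($0\le m\le d$), $a_m$, $b_{m,k}$ as defined in the context, and set $\mathcal{G}_{d+1}(z)=0$. Define polynomials $p_m(z),q_m(z)$ for $1\le m\le d+1$ by $p_1(z)=q_1(z)=1$ and, for $1\le m\le d$, \[ p_{m+1}(z)=p_m(z)-\sum_{k=0}^{m-1}b_{m,k}z^{m-k}p_{k+1}(z),\qquad q_{m+1}(z)=q_m(z)+z^ma_m-\sum_{k=0}^{m-1}b_{m,k}z^{m-k}q_{k+1}(z). \] Then for every $1\le m\le d+1$, $\mathcal{G}_m(z)=\frac{1}{z^m}\big(p_m(z)\mathcal{G}_0(z)-q_m(z)\big)$.
   Context: $\ell_0=|V\Gamma|$, $\ell_k=|\mathrm{Lk}(\sigma)|$ for any $k$-clique $\sigma$ ($1\le k\le d$), where $\mathrm{Lk}(\sigma)=\{v\notin\sigma\mid\sigma\cup\{v\}\text{ clique}\}$; link-regular means cliques of equal size have links of equal size. Define $\delta$ on cliques by $\delta(\sigma,v)=(\mathrm{Lk}(v)\cap\sigma)\cup\{v\}$ if $v\notin\sigma$ (with $\mathrm{Lk}(v)$ the neighbours of $v$) and $\delta(\sigma,v)=q_{\mathrm{rej}}$ (absorbing) if $v\in\sigma$, extended to words. For a clique $\sigma$, $\Delta_\sigma(z)=\sum_nc_nz^n$ with $c_n$ the number of words $x$ of length $n$ over $V\Gamma$ with $\delta(\sigma,x)\ne q_{\mathrm{rej}}$. $\mathcal{G}_0(z)=\Delta_\varnothing(z)$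 and $\mathcal{G}_m(z)=\sum\Delta_{\{v_1,\dots,v_m\}}(z)$ over all ordered $m$-cliques $(v_1,\dots,v_m)$ (tuples of distinct vertices forming a clique). Put $a_0=1$, $a_m=\ell_0\cdots\ell_{m-1}$ for $1\le m\le d$; $b_{0,0}=1$ and $b_{m,k}=\binom{m}{k}N_{m,k}$ for $1\le m\le d$, $0\le k\le m$, where $N_{m,m}=1$, $N_{m,m-1}=\ell_{m-1}-\ell_m-1$, and $N_{m,k}=\left(\prod_{k<j<m}\ell_j\right)\sum_{j=k}^m\binom{m-k}{j-k}(-1)^{j-k}\ell_j$ for $k<m-1$. -}

module Defs where

open import Data.Bool using (Bool; true; false; _∧_; _∨_; not; if_then_else_)
open import Data.Nat as ℕ using (ℕ; zero; suc; _∸_; _<ᵇ_; _≤ᵇ_)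
open import Data.Nat.Combinatorics using (_C_)
open import Data.Integer as ℤ using (ℤ; +_; -_)
open import Data.Fin using (Fin; toℕ; _≟_)
open import Data.Fin.Subset using (Subset; ⁅_⁆; _∩_; _∪_; ∣_∣; ⊥)
open import Data.Vec as Vec using (Vec; []; _∷_; _∷ʳ_; lookup; tabulate)
open import Data.List as List using (List; []; _∷_; allFin; upTo; concatMap; filterᵇ; length)
open import Data.Bool.ListAction using (and)
open import Data.Maybe using (Maybe; just; nothing; is-just)
open import Relation.Nullary using (does)

-- Graphs on vertex set Fin n, given by a Boolean adjacency relation E.
-- (Simplicity: E symmetric and irreflexive, imposed in the statement.)

allᵇ : ∀ {A : Set} → (A → Bool) → List A → Bool
allᵇ f xs = and (List.map f xs)

Adj : ℕ → Set
Adj n = Fin n → Fin n → Bool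

_≠ᵇ_ : ∀ {n} → Fin n → Fin n → Bool
u ≠ᵇ v = not (does (u ≟ v))

isCliqueᵇ : ∀ {n} → Adj n → Subset n → Bool
isCliqueᵇ {n} E σ =
  allᵇ (λ u → allᵇ (λ v → not (lookup σ u ∧ lookup σ v ∧ (u ≠ᵇ v)) ∨ E u v) (allFin n)) (allFin n)

IsClique : ∀ {n} → Adj n → Subset n → Set
IsClique E σ = isCliqueᵇ E σ ≡ true
  where open import Relation.Binary.PropositionalEquality using (_≡_)

Lk : ∀ {n} → Adj n → Subset n → Subset n
Lk E σ = tabulate (λ v → not (lookup σ v) ∧ isCliqueᵇ E (σ ∪ ⁅ v ⁆))

nbr : ∀ {n} → Adj n → Fin n → Subset n
nbr E v = tabulate (E v)

-- The automaton δ; nothing = q_rej (absorbing).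

δ : ∀ {n} → Adj n → Maybe (Subset n) → Fin n → Maybe (Subset n)
δ E nothing  v = nothing
δ E (just σ) v = if lookup σ v then nothing else just ((nbr E v ∩ σ) ∪ ⁅ v ⁆)

δ* : ∀ {n l} → Adj n → Maybe (Subset n) → Vec (Fin n) l → Maybe (Subset n)
δ* E s []       = s
δ* E s (v ∷ xs) = δ* E (δ E s v) xs

words : ∀ {n} (l : ℕ) → List (Vec (Fin n) l)
words {n} zero    = [] ∷ []
words {n} (suc l) = concatMap (λ v → List.map (v ∷_) (words l)) (allFin n)

Series : Set
Series = ℕ → ℤ

0ˢ 1ˢ : Series
0ˢ _ = + 0
1ˢ zero    = + 1
1ˢ (suc _) = + 0

_+ˢ_ _-ˢ_ _*ˢ_ : Series → Series → Series
(f +ˢ g) i = f i ℤ.+ g i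
(f -ˢ g) i = f i ℤ.- g i
(f *ˢ g) i = List.foldr ℤ._+_ (+ 0) (List.map (λ j → f j ℤ.* g (i ∸ j)) (upTo (suc i)))

infixl 6 _+ˢ_ _-ˢ_
infixl 7 _*ˢ_

scale : ℤ → Series → Series
scale c f i = c ℤ.* f i

-- multiplication by z^j
shift : ℕ → Series → Series
shift j f i = if i <ᵇ j then + 0 else f (i ∸ j)

sumˢ : List Series → Series
sumˢ = List.foldr _+ˢ_ 0ˢ

_≈ˢ_ : Series → Series → Set
f ≈ˢ g = ∀ i → f i ≡ g i
  where open import Relation.Binary.PropositionalEquality using (_≡_)

Δ : ∀ {n} → Adj n → Subset n → Series
Δ E σ l = + length (filterᵇ (λ x → is-just (δ* E (just σ) x)) (words l))

𝒢₀ : ∀ {n} → Adj n → Series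
𝒢₀ E = Δ E ⊥

toSet : ∀ {n m} → Vec (Fin n) m → Subset n
toSet []       = ⊥
toSet (v ∷ vs) = ⁅ v ⁆ ∪ toSet vs

isOrdCliqueᵇ : ∀ {n m} → Adj n → Vec (Fin n) m → Bool
isOrdCliqueᵇ {n} {m} E t =
  allᵇ (λ i → allᵇ (λ j → not (i ≠ᵇ j) ∨ ((lookup t i ≠ᵇ lookup t j) ∧ E (lookup t i) (lookup t j)))
    (allFin m)) (allFin m)

𝒢 : ∀ {n} → Adj n → ℕ → Series
𝒢 E m = sumˢ (List.map (λ t → Δ E (toSet t)) (filterᵇ (isOrdCliqueᵇ E) (words m)))

𝒢ᵈ : ∀ {n} → Adj n → ℕ → ℕ → Series
𝒢ᵈ E d m = if m ≤ᵇ d then 𝒢 E m else 0ˢ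

a : (ℕ → ℕ) → ℕ → ℤ
a ℓ zero    = + 1
a ℓ (suc m) = a ℓ m ℤ.* + ℓ m

prodℤ sumℤ : List ℤ → ℤ
prodℤ = List.foldr ℤ._*_ (+ 1)
sumℤ  = List.foldr ℤ._+_ (+ 0)

signPow : ℕ → ℤ
signPow zero    = + 1
signPow (suc i) = - signPow i

-- N_{m,k}, meaningful for k ≤ m
N : (ℕ → ℕ) → ℕ → ℕ → ℤ
N ℓ m k with m ∸ k
... | zero        = + 1
... | suc zero    = + ℓ (m ∸ 1) ℤ.- + ℓ m ℤ.- + 1
... | suc (suc t) =
  prodℤ (List.map (λ i → + ℓ (suc k ℕ.+ i)) (upTo (m ∸ k ∸ 1)))
  ℤ.* sumℤ (List.map (λ i → + ((m ∸ k) C i) ℤ.* signPow i ℤ.* + ℓ (k ℕ.+ i)) (upTo (suc (m ∸ k))))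

b : (ℕ → ℕ) → ℕ → ℕ → ℤ
b ℓ m k = + (m C k) ℤ.* N ℓ m k

-- The recursions for p_m, q_m.  recVec ℓ init extra m = [r₁, …, r_{m+1}]
-- with r₁ = init and
--   r_{m+1} = r_m + extra m − Σ_{k=0}^{m-1} b_{m,k} z^{m−k} r_{k+1}.

recVec : (ℕ → ℕ) → Series → (ℕ → Series) → (m : ℕ) → Vec Series (suc m)
recVec ℓ init extra zero    = init ∷ []
recVec ℓ init extra (suc m) =
  prev ∷ʳ (Vec.last prev +ˢ extra (suc m)
           -ˢ sumˢ (List.map (λ k → scale (b ℓ (suc m) (toℕ k)) (shift (suc m ∸ toℕ k) (lookup prev k)))
                              (allFin (suc m))))
  where prev = recVec ℓ init extra m

-- p_m and q_m for m ≥ 1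
p : (ℕ → ℕ) → ℕ → Series
p ℓ m = Vec.last (recVec ℓ 1ˢ (λ _ → 0ˢ) (m ∸ 1))

q : (ℕ → ℕ) → ℕ → Series
q ℓ m = Vec.last (recVec ℓ 1ˢ (λ j → scale (a ℓ j) (shift j 1ˢ)) (m ∸ 1))

-- Link-regularity makes every count depend only on clique sizes.  Reading a letter v from a clique
-- σ of size m either rejects (v ∈ σ) or leads to a clique of size 1 + |N(v) ∩ σ|, and the number of
-- v ∉ σ with exactly j neighbours in σ is an inclusion–exclusion expression F 0 m j in ℓ, found by
-- peeling the vertices of σ off one at a time.  Hence Δ_σ = Φ_{|σ|}, where Φ_{l+1}(m) =
-- Σ_j F(0,m,j) Φ_l(j+1), and as there are a_m ordered m-cliques, 𝒢_m = a_m Φ(m).  The identities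
-- a_m F(0,m,j) = b_{m,j} a_{j+1} (j < m) and a_m F(0,m,m) = a_{m+1} turn this into the recurrence
-- z 𝒢_{m+1} = 𝒢_m − a_m − Σ_{k<m} b_{m,k} z 𝒢_{k+1}, where 𝒢_{d+1} = 0 since there are no
-- (d+1)-cliques; substituting the earlier 𝒢_k = z^{-k}(p_k 𝒢_0 − q_k) reproduces the recursions
-- defining p_{m+1} and q_{m+1}.

module Submission where

open import Defs
open import Data.Bool using (Bool; true; false; _∧_; _∨_; not; if_then_else_)
open import Data.Bool.Properties using (∧-zeroʳ; ∧-identityʳ; ∨-zeroʳ; ∨-identityʳ; ∧-assoc)
open import Data.Nat as ℕ using (ℕ; zero; suc; _∸_; _≤_; _<_; z≤n; s≤s; _≡ᵇ_; _<ᵇ_)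
import Data.Nat.Properties as ℕP
open import Data.Nat.Combinatorics using (_C_; nCk+nC[k+1]≡[n+1]C[k+1]; nCn≡1; k>n⇒nCk≡0)
open import Data.Integer using (ℤ; +_; -_; _+_; _-_; _*_)
import Data.Integer.Properties as ℤP
open import Data.Integer.Tactic.RingSolver using (solve-∀)
open import Data.Fin as Fin using (Fin; toℕ; _≟_)
open import Data.Fin.Subset using (Subset; ∣_∣; ⁅_⁆; _∪_; _∩_; ⊥)
open import Data.Fin.Subset.Properties using (∣⊥∣≡0)
open import Data.Vec as Vec using (Vec; lookup; tabulate; _∷ʳ_)
open import Data.Vec.Properties using (last-∷ʳ; lookup-zipWith; lookup∘tabulate; tabulate∘lookup; lookup-replicate)
open import Data.List as List using (List; []; _∷_; upTo; applyUpTo; allFin; length; filterᵇ)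
open import Data.List.Properties using (map-applyUpTo; map-tabulate; map-cong)
open import Data.Maybe using (just; nothing; is-just)
open import Data.Product using (Σ; _×_; _,_; proj₁; proj₂)
open import Data.Sum using (_⊎_; inj₁; inj₂)
open import Data.Empty using (⊥-elim)
open import Function using (_∘_)
open import Relation.Nullary using (Dec; does; yes; no)
open import Relation.Nullary.Decidable using (dec-true; dec-false)
open import Relation.Binary.PropositionalEquality renaming (trans to infixr 5 _∙_)
open import Algebra.Properties.CommutativeSemigroup ℤP.+-commutativeSemigroup
  using () renaming (interchange to +-interchange)
open import Algebra.Properties.Ring ℤP.+-*-ring using ([y-z]x≈yx-zx; x[y-z]≈xy-xz)
import Algebra.Properties.CommutativeMonoid.Sum ℕP.+-0-commutativeMonoid as ℕΣ
import Relation.Binary.Reasoning.Setoid (ℕ →-setoid ℤ) as ≈ˢ-Reasoning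

private
  variable
    A B : Set

ι : Bool → ℕ
ι b = if b then 1 else 0

∧-true : ∀ {a b} → a ∧ b ≡ true → a ≡ true × b ≡ true
∧-true {true} {true} _ = refl , refl

∨-true : ∀ a {b} → a ∨ b ≡ true → a ≡ true ⊎ b ≡ true
∨-true true _ = inj₁ refl
∨-true false e = inj₂ e

∨-false : ∀ {a b} → a ∨ b ≡ false → a ≡ false × b ≡ false
∨-false {false} {false} _ = refl , refl

not-true : ∀ {b} → not b ≡ true → b ≡ false
not-true {false} _ = refl

bool-ext : ∀ {a b : Bool} → (a ≡ true → b ≡ true) → (b ≡ true → a ≡ true) → a ≡ b
bool-ext {true} f g = sym (f refl)
bool-ext {false} {true} f g = g refl
bool-ext {false} {false} f g = refl

true≢false : true ≢ false
true≢false ()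

does-≟-true : ∀ {n} {u v : Fin n} → does (u ≟ v) ≡ true → u ≡ v
does-≟-true {u = u} {v} e with u ≟ v
... | yes u≡v = u≡v

-- Finite sums

∑ : (A → ℤ) → List A → ℤ
∑ f xs = sumℤ (List.map f xs)

∑-++ : (f : A → ℤ) (xs ys : List A) → ∑ f (xs List.++ ys) ≡ ∑ f xs + ∑ f ys
∑-++ f [] ys = sym (ℤP.+-identityˡ (∑ f ys))
∑-++ f (x ∷ xs) ys = cong (_+_ (f x)) (∑-++ f xs ys) ∙ sym (ℤP.+-assoc (f x) _ _)

∑-cong : {f g : A → ℤ} (xs : List A) → (∀ x → f x ≡ g x) → ∑ f xs ≡ ∑ g xs
∑-cong [] h = refl
∑-cong (x ∷ xs) h = cong₂ _+_ (h x) (∑-cong xs h)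

∑-zero : {f : A → ℤ} (xs : List A) → (∀ x → f x ≡ + 0) → ∑ f xs ≡ + 0
∑-zero [] h = refl
∑-zero (x ∷ xs) h = cong₂ _+_ (h x) (∑-zero xs h)

∑-distrib-+ : (f g : A → ℤ) (xs : List A) → ∑ (λ x → f x + g x) xs ≡ ∑ f xs + ∑ g xs
∑-distrib-+ f g [] = refl
∑-distrib-+ f g (x ∷ xs) =
  cong (_+_ (f x + g x)) (∑-distrib-+ f g xs) ∙ +-interchange (f x) (g x) (∑ f xs) (∑ g xs)

∑-distrib-- : (f g : A → ℤ) (xs : List A) → ∑ (λ x → f x - g x) xs ≡ ∑ f xs - ∑ g xs
∑-distrib-- f g [] = refl
∑-distrib-- f g (x ∷ xs) = begin
  (f x - g x) + ∑ (λ x → f x - g x) xs    ≡⟨ cong (_+_ (f x - g x)) (∑-distrib-- f g xs) ⟩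
  (f x - g x) + (∑ f xs - ∑ g xs)         ≡⟨ +-interchange (f x) (- g x) (∑ f xs) (- ∑ g xs) ⟩
  (f x + ∑ f xs) + (- g x - ∑ g xs)       ≡⟨ cong (_+_ (f x + ∑ f xs)) (sym (ℤP.neg-distrib-+ (g x) (∑ g xs))) ⟩
  (f x + ∑ f xs) - (g x + ∑ g xs)         ∎
  where open ≡-Reasoning

∑-*ˡ : (c : ℤ) (f : A → ℤ) (xs : List A) → ∑ (λ x → c * f x) xs ≡ c * ∑ f xs
∑-*ˡ c f [] = sym (ℤP.*-zeroʳ c)
∑-*ˡ c f (x ∷ xs) rewrite ∑-*ˡ c f xs = sym (ℤP.*-distribˡ-+ c (f x) _)

∑-map : (g : B → ℤ) (F : A → B) (xs : List A) → ∑ g (List.map F xs) ≡ ∑ (g ∘ F) xs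
∑-map g F [] = refl
∑-map g F (x ∷ xs) = cong (_+_ (g (F x))) (∑-map g F xs)

∑-filter-const : (P : A → Bool) {f : A → ℤ} {c : ℤ} (xs : List A) → (∀ x → P x ≡ true → f x ≡ c)
  → ∑ f (filterᵇ P xs) ≡ + length (filterᵇ P xs) * c
∑-filter-const P {c = c} [] h = sym (ℤP.*-zeroˡ c)
∑-filter-const P {f} {c} (x ∷ xs) h with P x in Px
... | false = ∑-filter-const P xs h
... | true = cong₂ _+_ (h x Px) (∑-filter-const P xs h) ∙
                   sym (ℤP.suc-* (+ length (filterᵇ P xs)) c)

∑-concatMap : (f : B → ℤ) (g : A → List B) (xs : List A) → ∑ f (List.concatMap g xs) ≡ ∑ (λ x → ∑ f (g x)) xs
∑-concatMap f g [] = refl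
∑-concatMap f g (x ∷ xs) = ∑-++ f (g x) (List.concatMap g xs) ∙ cong (_+_ (∑ f (g x))) (∑-concatMap f g xs)

∑-swap : (f : A → B → ℤ) (xs : List A) (ys : List B) → ∑ (λ x → ∑ (f x) ys) xs ≡ ∑ (λ y → ∑ (λ x → f x y) xs) ys
∑-swap f [] ys = sym (∑-zero ys (λ _ → refl))
∑-swap f (x ∷ xs) ys = cong (_+_ (∑ (f x) ys)) (∑-swap f xs ys) ∙ sym (∑-distrib-+ (f x) (λ y → ∑ (λ x → f x y) xs) ys)

∑-if : (P : A → Bool) {c : ℤ} (xs : List A) → ∑ (λ x → if P x then c else + 0) xs ≡ + length (filterᵇ P xs) * c
∑-if P {c} [] = sym (ℤP.*-zeroˡ c)
∑-if P {c} (x ∷ xs) with P x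
... | true = cong (_+_ c) (∑-if P xs) ∙ sym (ℤP.suc-* (+ length (filterᵇ P xs)) c)
... | false = ℤP.+-identityˡ _ ∙ ∑-if P xs

+length-filter : (P : A → Bool) (xs : List A) → + length (filterᵇ P xs) ≡ ∑ (λ x → + ι (P x)) xs
+length-filter P xs = sym (ℤP.*-identityʳ _) ∙ sym (∑-cong xs ι-as-if ∙ ∑-if P xs)
  where
  ι-as-if : ∀ x → + ι (P x) ≡ (if P x then + 1 else + 0)
  ι-as-if x with P x
  ... | true = refl
  ... | false = refl

∑-applyUpTo : (f : ℕ → ℤ) (g : ℕ → ℕ) (n : ℕ) → ∑ f (applyUpTo g n) ≡ ∑ (f ∘ g) (upTo n)
∑-applyUpTo f g n = cong sumℤ (map-applyUpTo g f n ∙ sym (map-applyUpTo (λ x → x) (f ∘ g) n))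

∑-applyUpTo-suc : (f : ℕ → ℤ) (g : ℕ → ℕ) (n : ℕ) → ∑ f (applyUpTo g (suc n)) ≡ ∑ f (applyUpTo g n) + f (g n)
∑-applyUpTo-suc f g zero = ℤP.+-identityʳ (f (g 0)) ∙ sym (ℤP.+-identityˡ (f (g 0)))
∑-applyUpTo-suc f g (suc n) =
  cong (_+_ (f (g 0))) (∑-applyUpTo-suc f (g ∘ suc) n) ∙ sym (ℤP.+-assoc (f (g 0)) _ _)

∑-upTo-suc : (f : ℕ → ℤ) (n : ℕ) → ∑ f (upTo (suc n)) ≡ ∑ f (upTo n) + f n
∑-upTo-suc f = ∑-applyUpTo-suc f (λ x → x)

∑-upTo-cong : ∀ n {f g : ℕ → ℤ} → (∀ j → j < n → f j ≡ g j) → ∑ f (upTo n) ≡ ∑ g (upTo n)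
∑-upTo-cong zero h = refl
∑-upTo-cong (suc n) {f} {g} h = begin
  ∑ f (upTo (suc n))       ≡⟨ ∑-upTo-suc f n ⟩
  ∑ f (upTo n) + f n     ≡⟨ cong₂ _+_ (∑-upTo-cong n (λ j j<n → h j (ℕP.m<n⇒m<1+n j<n))) (h n ℕP.≤-refl) ⟩
  ∑ g (upTo n) + g n     ≡⟨ sym (∑-upTo-suc g n) ⟩
  ∑ g (upTo (suc n))       ∎
  where open ≡-Reasoning

∑-allFin : ∀ m (f : ℕ → ℤ) → ∑ (f ∘ toℕ) (allFin m) ≡ ∑ f (upTo m)
∑-allFin zero f = refl
∑-allFin (suc m) f = cong (_+_ (f 0)) (begin
  ∑ (f ∘ toℕ) (List.tabulate {n = m} Fin.suc)   ≡⟨ cong (∑ (f ∘ toℕ)) (sym (map-tabulate {n = m} (λ x → x) Fin.suc)) ⟩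
  ∑ (f ∘ toℕ) (List.map Fin.suc (allFin m))     ≡⟨ ∑-map (f ∘ toℕ) Fin.suc (allFin m) ⟩
  ∑ (f ∘ suc ∘ toℕ) (allFin m)                  ≡⟨ ∑-allFin m (f ∘ suc) ⟩
  ∑ (f ∘ suc) (upTo m)                          ≡⟨ sym (∑-applyUpTo f suc m) ⟩
  ∑ f (applyUpTo suc m)                         ∎)
  where open ≡-Reasoning

∑-allFin-suc : ∀ {n} (f : Fin (suc n) → ℤ) → ∑ f (allFin (suc n)) ≡ f Fin.zero + ∑ (f ∘ Fin.suc) (allFin n)
∑-allFin-suc {n} f = cong (_+_ (f Fin.zero)) (cong (∑ f) (sym (map-tabulate {n = n} (λ x → x) Fin.suc)) ∙ ∑-map f Fin.suc (allFin n))

δ-term : ℕ → (ℕ → ℤ) → ℕ → ℤ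
δ-term k h j = if k ≡ᵇ j then h j else + 0

∑-upTo-δ : ∀ {k} m (h : ℕ → ℤ) → k ≤ m → ∑ (δ-term k h) (upTo (suc m)) ≡ h k
∑-upTo-δ {k} m h k≤m with ℕP.m≤n⇒m<n∨m≡n k≤m
∑-upTo-δ {k} (suc m) h _ | inj₁ k<1+m@(s≤s k≤m) =
  ∑-upTo-suc (δ-term k h) (suc m)
  ∙ cong₂ _+_ (∑-upTo-δ m h k≤m) (cong (λ b → if b then h (suc m) else + 0) (dec-false (k ℕP.≟ suc m) (ℕP.<⇒≢ k<1+m)))
  ∙ ℤP.+-identityʳ (h k)
∑-upTo-δ {k} _ h _ | inj₂ refl =
  ∑-upTo-suc (δ-term k h) k
  ∙ cong₂ _+_ (∑-upTo-cong k (λ j j<k → cong (λ b → if b then h j else + 0) (dec-false (k ℕP.≟ j) (ℕP.>⇒≢ j<k)))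
               ∙ ∑-zero (upTo k) (λ _ → refl))
              (cong (λ b → if b then h k else + 0) (dec-true (k ℕP.≟ k) refl))
  ∙ ℤP.+-identityˡ (h k)

-- Formal power series

sumˢ-map : (F : A → Series) (xs : List A) (i : ℕ) → sumˢ (List.map F xs) i ≡ ∑ (λ x → F x i) xs
sumˢ-map F [] i = refl
sumˢ-map F (x ∷ xs) i = cong (_+_ (F x i)) (sumˢ-map F xs i)

-ˢ-cong : {f f′ g g′ : Series} → f ≈ˢ f′ → g ≈ˢ g′ → (f -ˢ g) ≈ˢ (f′ -ˢ g′)
-ˢ-cong e e′ i = cong₂ _-_ (e i) (e′ i)

*ˢ-congʳ : {f g : Series} (h : Series) → f ≈ˢ g → (f *ˢ h) ≈ˢ (g *ˢ h)
*ˢ-congʳ h e i = ∑-cong (upTo (suc i)) (λ j → cong (_* h (i ∸ j)) (e j))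

*ˢ-suc : (f h : Series) (i : ℕ) → (f *ˢ h) (suc i) ≡ f 0 * h (suc i) + ∑ (λ j → f (suc j) * h (i ∸ j)) (upTo (suc i))
*ˢ-suc f h i = cong (_+_ (f 0 * h (suc i))) (∑-applyUpTo (λ j → f j * h (suc i ∸ j)) suc (suc i))

*ˢ-distribʳ--ˢ : (f g h : Series) → ((f -ˢ g) *ˢ h) ≈ˢ (f *ˢ h -ˢ g *ˢ h)
*ˢ-distribʳ--ˢ f g h i = ∑-cong (upTo (suc i)) (λ j → [y-z]x≈yx-zx (h (i ∸ j)) (f j) (g j)) ∙
                               ∑-distrib-- (λ j → f j * h (i ∸ j)) (λ j → g j * h (i ∸ j)) (upTo (suc i))

scale-*ˢ : (c : ℤ) (f h : Series) → (scale c f *ˢ h) ≈ˢ scale c (f *ˢ h)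
scale-*ˢ c f h i = ∑-cong (upTo (suc i)) (λ j → ℤP.*-assoc c (f j) (h (i ∸ j))) ∙
                         ∑-*ˡ c (λ j → f j * h (i ∸ j)) (upTo (suc i))

sumˢ-*ˢ : (fs : List Series) (h : Series) → (sumˢ fs *ˢ h) ≈ˢ sumˢ (List.map (_*ˢ h) fs)
sumˢ-*ˢ [] h i = ∑-zero (upTo (suc i)) (λ j → ℤP.*-zeroˡ (h (i ∸ j)))
sumˢ-*ˢ (f ∷ fs) h i = begin
  ((f +ˢ sumˢ fs) *ˢ h) i                               ≡⟨ ∑-cong (upTo (suc i)) (λ j → ℤP.*-distribʳ-+ (h (i ∸ j)) (f j) _) ⟩
  ∑ (λ j → f j * h (i ∸ j) + sumˢ fs j * h (i ∸ j)) (upTo (suc i))  ≡⟨ ∑-distrib-+ (λ j → f j * h (i ∸ j)) (λ j → sumˢ fs j * h (i ∸ j)) (upTo (suc i)) ⟩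
  (f *ˢ h) i + (sumˢ fs *ˢ h) i                         ≡⟨ cong (_+_ ((f *ˢ h) i)) (sumˢ-*ˢ fs h i) ⟩
  (f *ˢ h) i + sumˢ (List.map (_*ˢ h) fs) i             ∎
  where open ≡-Reasoning

1ˢ-*ˢ : (h : Series) → (1ˢ *ˢ h) ≈ˢ h
1ˢ-*ˢ h zero = ℤP.+-identityʳ _ ∙ ℤP.*-identityˡ (h 0)
1ˢ-*ˢ h (suc i) = begin
  (1ˢ *ˢ h) (suc i)                                        ≡⟨ *ˢ-suc 1ˢ h i ⟩
  + 1 * h (suc i) + ∑ (λ j → + 0 * h (i ∸ j)) (upTo (suc i)) ≡⟨ cong₂ _+_ (ℤP.*-identityˡ (h (suc i))) (∑-zero (upTo (suc i)) (λ j → ℤP.*-zeroˡ (h (i ∸ j)))) ⟩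
  h (suc i) + + 0                                          ≡⟨ ℤP.+-identityʳ (h (suc i)) ⟩
  h (suc i)                                                ∎
  where open ≡-Reasoning

shift-*ˢ : (s : ℕ) (f h : Series) → (shift s f *ˢ h) ≈ˢ shift s (f *ˢ h)
shift-*ˢ zero f h i = refl
shift-*ˢ (suc s) f h zero = ℤP.+-identityʳ _ ∙ ℤP.*-zeroˡ (h 0)
shift-*ˢ (suc s) f h (suc i) = begin
  (shift (suc s) f *ˢ h) (suc i)                                                 ≡⟨ *ˢ-suc (shift (suc s) f) h i ⟩
  + 0 * h (suc i) + ∑ (λ j → shift s f j * h (i ∸ j)) (upTo (suc i))            ≡⟨ cong (_+ ∑ (λ j → shift s f j * h (i ∸ j)) (upTo (suc i))) (ℤP.*-zeroˡ (h (suc i))) ⟩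
  + 0 + (shift s f *ˢ h) i                                                       ≡⟨ ℤP.+-identityˡ _ ⟩
  (shift s f *ˢ h) i                                                             ≡⟨ shift-*ˢ s f h i ⟩
  shift s (f *ˢ h) i                                                             ∎
  where open ≡-Reasoning

shift-cong : (s : ℕ) {f g : Series} → f ≈ˢ g → shift s f ≈ˢ shift s g
shift-cong zero e i = e i
shift-cong (suc s) e zero = refl
shift-cong (suc s) e (suc i) = shift-cong s e i

shift-+ˢ : (s : ℕ) (f g : Series) → shift s (f +ˢ g) ≈ˢ (shift s f +ˢ shift s g)
shift-+ˢ zero f g i = refl
shift-+ˢ (suc s) f g zero = refl
shift-+ˢ (suc s) f g (suc i) = shift-+ˢ s f g i

shift--ˢ : (s : ℕ) (f g : Series) → shift s (f -ˢ g) ≈ˢ (shift s f -ˢ shift s g)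
shift--ˢ zero f g i = refl
shift--ˢ (suc s) f g zero = refl
shift--ˢ (suc s) f g (suc i) = shift--ˢ s f g i

shift-scale : (s : ℕ) (c : ℤ) (f : Series) → shift s (scale c f) ≈ˢ scale c (shift s f)
shift-scale zero c f i = refl
shift-scale (suc s) c f zero = sym (ℤP.*-zeroʳ c)
shift-scale (suc s) c f (suc i) = shift-scale s c f i

shift-shift : (s t : ℕ) (f : Series) → shift s (shift t f) ≈ˢ shift (s ℕ.+ t) f
shift-shift zero t f i = refl
shift-shift (suc s) t f zero = refl
shift-shift (suc s) t f (suc i) = shift-shift s t f i

shift-shift-≡ : ∀ {s t s′ t′} → s ℕ.+ t ≡ s′ ℕ.+ t′ → (f : Series) → shift s (shift t f) ≈ˢ shift s′ (shift t′ f)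
shift-shift-≡ {s} {t} {s′} {t′} e f i =
  shift-shift s t f i ∙ (cong (λ r → shift r f i) e ∙ sym (shift-shift s′ t′ f i))

shift-0ˢ : (s : ℕ) → shift s 0ˢ ≈ˢ 0ˢ
shift-0ˢ s i with i <ᵇ s
... | true = refl
... | false = refl

shift-sumˢ : (s : ℕ) (fs : List Series) → shift s (sumˢ fs) ≈ˢ sumˢ (List.map (shift s) fs)
shift-sumˢ s [] = shift-0ˢ s
shift-sumˢ s (f ∷ fs) i = shift-+ˢ s f (sumˢ fs) i ∙ cong (_+_ (shift s f i)) (shift-sumˢ s fs i)

∑ˢ : (ℕ → ℤ) → ℕ → (ℕ → Series) → Series
∑ˢ w m X = sumˢ (List.map (λ k → scale (w (toℕ k)) (X (toℕ k))) (allFin m))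

∑ˢ-at : (w : ℕ → ℤ) (m : ℕ) (X : ℕ → Series) (i : ℕ) → ∑ˢ w m X i ≡ ∑ (λ k → w k * X k i) (upTo m)
∑ˢ-at w m X i = sumˢ-map (λ k → scale (w (toℕ k)) (X (toℕ k))) (allFin m) i ∙ ∑-allFin m (λ k → w k * X k i)

module _ (w : ℕ → ℤ) (m : ℕ) where

  ∑ˢ-cong : {X Y : ℕ → Series} → (∀ k → k < m → X k ≈ˢ Y k) → ∑ˢ w m X ≈ˢ ∑ˢ w m Y
  ∑ˢ-cong {X} {Y} e i = begin
    ∑ˢ w m X i                        ≡⟨ ∑ˢ-at w m X i ⟩
    ∑ (λ k → w k * X k i) (upTo m)    ≡⟨ ∑-upTo-cong m (λ k k<m → cong (w k *_) (e k k<m i)) ⟩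
    ∑ (λ k → w k * Y k i) (upTo m)    ≡⟨ ∑ˢ-at w m Y i ⟨
    ∑ˢ w m Y i                        ∎
    where open ≡-Reasoning

  ∑ˢ--ˢ : (X Y : ℕ → Series) → ∑ˢ w m (λ k → X k -ˢ Y k) ≈ˢ (∑ˢ w m X -ˢ ∑ˢ w m Y)
  ∑ˢ--ˢ X Y i = begin
    ∑ˢ w m (λ k → X k -ˢ Y k) i                               ≡⟨ ∑ˢ-at w m (λ k → X k -ˢ Y k) i ⟩
    ∑ (λ k → w k * (X k i - Y k i)) (upTo m)                   ≡⟨ ∑-cong (upTo m) (λ k → x[y-z]≈xy-xz (w k) (X k i) (Y k i)) ⟩
    ∑ (λ k → w k * X k i - w k * Y k i) (upTo m)               ≡⟨ ∑-distrib-- (λ k → w k * X k i) (λ k → w k * Y k i) (upTo m) ⟩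
    ∑ (λ k → w k * X k i) (upTo m) - ∑ (λ k → w k * Y k i) (upTo m) ≡⟨ cong₂ _-_ (∑ˢ-at w m X i) (∑ˢ-at w m Y i) ⟨
    ∑ˢ w m X i - ∑ˢ w m Y i                                    ∎
    where open ≡-Reasoning

  ∑ˢ-*ˢ : (X : ℕ → Series) (h : Series) → (∑ˢ w m X *ˢ h) ≈ˢ ∑ˢ w m (λ k → X k *ˢ h)
  ∑ˢ-*ˢ X h i = begin
    (∑ˢ w m X *ˢ h) i                                   ≡⟨ sumˢ-*ˢ (List.map term (allFin m)) h i ⟩
    sumˢ (List.map (_*ˢ h) (List.map term (allFin m))) i  ≡⟨ sumˢ-map (_*ˢ h) (List.map term (allFin m)) i ⟩
    ∑ (λ f → (f *ˢ h) i) (List.map term (allFin m))     ≡⟨ ∑-map (λ f → (f *ˢ h) i) term (allFin m) ⟩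
    ∑ (λ k → (term k *ˢ h) i) (allFin m)                ≡⟨ ∑-cong (allFin m) (λ k → scale-*ˢ (w (toℕ k)) (X (toℕ k)) h i) ⟩
    ∑ (λ k → w (toℕ k) * (X (toℕ k) *ˢ h) i) (allFin m) ≡⟨ sumˢ-map (λ k → scale (w (toℕ k)) (X (toℕ k) *ˢ h)) (allFin m) i ⟨
    ∑ˢ w m (λ k → X k *ˢ h) i                           ∎
    where open ≡-Reasoning
          term = λ (k : Fin m) → scale (w (toℕ k)) (X (toℕ k))

  shift-∑ˢ : (s : ℕ) (X : ℕ → Series) → shift s (∑ˢ w m X) ≈ˢ ∑ˢ w m (λ k → shift s (X k))
  shift-∑ˢ s X i = begin
    shift s (∑ˢ w m X) i                                      ≡⟨ shift-sumˢ s (List.map term (allFin m)) i ⟩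
    sumˢ (List.map (shift s) (List.map term (allFin m))) i    ≡⟨ sumˢ-map (shift s) (List.map term (allFin m)) i ⟩
    ∑ (λ f → shift s f i) (List.map term (allFin m))          ≡⟨ ∑-map (λ f → shift s f i) term (allFin m) ⟩
    ∑ (λ k → shift s (term k) i) (allFin m)                   ≡⟨ ∑-cong (allFin m) (λ k → shift-scale s (w (toℕ k)) (X (toℕ k)) i) ⟩
    ∑ (λ k → w (toℕ k) * shift s (X (toℕ k)) i) (allFin m)    ≡⟨ sumˢ-map (λ k → scale (w (toℕ k)) (shift s (X (toℕ k)))) (allFin m) i ⟨
    ∑ˢ w m (λ k → shift s (X k)) i                            ∎
    where open ≡-Reasoning
          term = λ (k : Fin m) → scale (w (toℕ k)) (X (toℕ k))

-- Solving the recurrence with p and q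

lookup-∷ʳ : {n : ℕ} (xs : Vec A n) (x : A) (k : Fin (suc n))
  → (Σ (Fin n) λ k′ → toℕ k′ ≡ toℕ k × lookup (xs ∷ʳ x) k ≡ lookup xs k′) ⊎ (toℕ k ≡ n × lookup (xs ∷ʳ x) k ≡ x)
lookup-∷ʳ Vec.[] x Fin.zero = inj₂ (refl , refl)
lookup-∷ʳ (y Vec.∷ ys) x Fin.zero = inj₁ (Fin.zero , refl , refl)
lookup-∷ʳ (y Vec.∷ ys) x (Fin.suc k) with lookup-∷ʳ ys x k
... | inj₁ (k′ , e , l) = inj₁ (Fin.suc k′ , cong suc e , l)
... | inj₂ (e , l) = inj₂ (cong suc e , l)

module _ (ℓ : ℕ → ℕ) (init : Series) (extra : ℕ → Series) where

  lookup-recVec : ∀ M (k : Fin (suc M)) → lookup (recVec ℓ init extra M) k ≡ Vec.last (recVec ℓ init extra (toℕ k))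
  lookup-recVec zero Fin.zero = refl
  lookup-recVec (suc M) k with lookup-∷ʳ (recVec ℓ init extra M) _ k
  ... | inj₁ (k′ , e , l) = l ∙ (lookup-recVec M k′ ∙ cong (Vec.last ∘ recVec ℓ init extra) e)
  ... | inj₂ (e , l) = l ∙ (sym (last-∷ʳ _ (recVec ℓ init extra M)) ∙ cong (Vec.last ∘ recVec ℓ init extra) (sym e))

  last-recVec-suc : ∀ M → Vec.last (recVec ℓ init extra (suc M))
    ≡ (Vec.last (recVec ℓ init extra M) +ˢ extra (suc M)
       -ˢ ∑ˢ (b ℓ (suc M)) (suc M) (λ k → shift (suc M ∸ k) (Vec.last (recVec ℓ init extra k))))
  last-recVec-suc M = last-∷ʳ _ (recVec ℓ init extra M) ∙
    cong (λ fs → Vec.last (recVec ℓ init extra M) +ˢ extra (suc M) -ˢ sumˢ fs)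
      (map-cong (λ k → cong (λ f → scale (b ℓ (suc M) (toℕ k)) (shift (suc M ∸ toℕ k) f)) (lookup-recVec M k))
                (allFin (suc M)))

p-suc : (ℓ : ℕ → ℕ) (m : ℕ) → p ℓ (suc (suc m)) ≡ (p ℓ (suc m) +ˢ 0ˢ -ˢ ∑ˢ (b ℓ (suc m)) (suc m) (λ k → shift (suc m ∸ k) (p ℓ (suc k))))
p-suc ℓ = last-recVec-suc ℓ 1ˢ (λ _ → 0ˢ)

q-suc : (ℓ : ℕ → ℕ) (m : ℕ) → q ℓ (suc (suc m))
  ≡ (q ℓ (suc m) +ˢ scale (a ℓ (suc m)) (shift (suc m) 1ˢ) -ˢ ∑ˢ (b ℓ (suc m)) (suc m) (λ k → shift (suc m ∸ k) (q ℓ (suc k))))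
q-suc ℓ = last-recVec-suc ℓ 1ˢ (λ j → scale (a ℓ j) (shift j 1ˢ))

module ClosedForm (ℓ : ℕ → ℕ) (G₀ : Series) (G : ℕ → Series) where

  G′ : ℕ → Series
  G′ zero = G₀
  G′ (suc m) = G (suc m)

  Recurrence : ℕ → Set
  Recurrence m = shift 1 (G (suc m)) ≈ˢ (G′ m -ˢ scale (a ℓ m) 1ˢ -ˢ ∑ˢ (b ℓ m) m (λ k → shift 1 (G (suc k))))

  Solved : ℕ → Set
  Solved j = shift (suc j) (G (suc j)) ≈ˢ (p ℓ (suc j) *ˢ G₀ -ˢ q ℓ (suc j))

  solved-zero : Recurrence 0 → Solved 0
  solved-zero rec i = begin
    shift 1 (G 1) i                      ≡⟨ rec i ⟩
    G₀ i - + 1 * 1ˢ i - + 0               ≡⟨ cong₂ (λ x y → x - y - + 0) (sym (1ˢ-*ˢ G₀ i)) (ℤP.*-identityˡ (1ˢ i)) ⟩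
    (1ˢ *ˢ G₀) i - 1ˢ i - + 0             ≡⟨ ℤP.+-identityʳ _ ⟩
    (1ˢ *ˢ G₀) i - 1ˢ i                   ∎
    where open ≡-Reasoning

  solved-suc : ∀ M → Recurrence (suc M) → (∀ j → j ≤ M → Solved j) → Solved (suc M)
  solved-suc M rec ih = begin
    shift (suc m) (G (suc m))
      ≈⟨ shift-shift-≡ {0} {suc m} {m} {1} (ℕP.+-comm 1 m) (G (suc m)) ⟩
    shift m (shift 1 (G (suc m)))
      ≈⟨ shift-cong m rec ⟩
    shift m (G m -ˢ aₘ -ˢ W (λ k → shift 1 (G (suc k))))
      ≈⟨ shift-expanded ⟩
    (shift m (G m) -ˢ shift m aₘ) -ˢ W (λ k → shift m (shift 1 (G (suc k))))
      ≈⟨ -ˢ-cong (-ˢ-cong (ih M ℕP.≤-refl) (shift-scale m (a ℓ m) 1ˢ)) (∑ˢ-cong (b ℓ m) m earlier) ⟩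
    (P m *ˢ G₀ -ˢ Q m) -ˢ aₘzᵐ -ˢ W (λ k → shift (m ∸ k) (P (suc k) *ˢ G₀ -ˢ Q (suc k)))
      ≈⟨ regrouped ⟩
    (P m +ˢ 0ˢ -ˢ W (λ k → shift (m ∸ k) (P (suc k)))) *ˢ G₀ -ˢ (Q m +ˢ aₘzᵐ -ˢ W (λ k → shift (m ∸ k) (Q (suc k))))
      ≡⟨ cong₂ (λ P Q → P *ˢ G₀ -ˢ Q) (p-suc ℓ M) (q-suc ℓ M) ⟨
    P (suc m) *ˢ G₀ -ˢ Q (suc m)
      ∎
    where
    open ≈ˢ-Reasoning
    m = suc M
    P = p ℓ
    Q = q ℓ
    aₘ = scale (a ℓ m) 1ˢ
    aₘzᵐ = scale (a ℓ m) (shift m 1ˢ)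
    W = ∑ˢ (b ℓ m) m

    shift-expanded : shift m (G m -ˢ aₘ -ˢ W (λ k → shift 1 (G (suc k))))
                     ≈ˢ ((shift m (G m) -ˢ shift m aₘ) -ˢ W (λ k → shift m (shift 1 (G (suc k)))))
    shift-expanded i = shift--ˢ m (G m -ˢ aₘ) (W (λ k → shift 1 (G (suc k)))) i ∙
      cong₂ _-_ (shift--ˢ m (G m) aₘ i) (shift-∑ˢ (b ℓ m) m m (λ k → shift 1 (G (suc k))) i)

    earlier : ∀ k → k < m → shift m (shift 1 (G (suc k))) ≈ˢ shift (m ∸ k) (P (suc k) *ˢ G₀ -ˢ Q (suc k))
    earlier k (s≤s k≤M) i = shift-shift-≡ {m} {1} {m ∸ k} {suc k} e (G (suc k)) i ∙ shift-cong (m ∸ k) (ih k k≤M) i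
      where e : m ℕ.+ 1 ≡ m ∸ k ℕ.+ suc k
            e = ℕP.+-comm m 1 ∙ sym (ℕP.+-comm (m ∸ k) (suc k) ∙ cong suc (ℕP.m+[n∸m]≡n (ℕP.m≤n⇒m≤1+n k≤M)))

    regrouped : ((P m *ˢ G₀ -ˢ Q m) -ˢ aₘzᵐ -ˢ W (λ k → shift (m ∸ k) (P (suc k) *ˢ G₀ -ˢ Q (suc k))))
                ≈ˢ ((P m +ˢ 0ˢ -ˢ W (λ k → shift (m ∸ k) (P (suc k)))) *ˢ G₀ -ˢ (Q m +ˢ aₘzᵐ -ˢ W (λ k → shift (m ∸ k) (Q (suc k)))))
    regrouped i = cong (λ x → (P m *ˢ G₀) i - Q m i - aₘzᵐ i - x) (W-split i) ∙
                        (lemma ((P m *ˢ G₀) i) (Q m i) (aₘzᵐ i) (Wp i) (Wq i) ∙ cong (λ x → x - (Q m i + aₘzᵐ i - Wq i)) (sym (P-split i)))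
      where
      Wp = W (λ k → shift (m ∸ k) (P (suc k))) *ˢ G₀
      Wq = W (λ k → shift (m ∸ k) (Q (suc k)))
      W-split : W (λ k → shift (m ∸ k) (P (suc k) *ˢ G₀ -ˢ Q (suc k))) ≈ˢ (Wp -ˢ Wq)
      W-split = begin
        W (λ k → shift (m ∸ k) (P (suc k) *ˢ G₀ -ˢ Q (suc k)))
          ≈⟨ ∑ˢ-cong (b ℓ m) m (λ k _ → shift--ˢ (m ∸ k) (P (suc k) *ˢ G₀) (Q (suc k))) ⟩
        W (λ k → shift (m ∸ k) (P (suc k) *ˢ G₀) -ˢ shift (m ∸ k) (Q (suc k)))
          ≈⟨ ∑ˢ--ˢ (b ℓ m) m (λ k → shift (m ∸ k) (P (suc k) *ˢ G₀)) (λ k → shift (m ∸ k) (Q (suc k))) ⟩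
        W (λ k → shift (m ∸ k) (P (suc k) *ˢ G₀)) -ˢ Wq
          ≈⟨ -ˢ-cong (∑ˢ-cong (b ℓ m) m (λ k _ → shift-*ˢ (m ∸ k) (P (suc k)) G₀)) (λ _ → refl) ⟨
        W (λ k → shift (m ∸ k) (P (suc k)) *ˢ G₀) -ˢ Wq
          ≈⟨ -ˢ-cong (∑ˢ-*ˢ (b ℓ m) m (λ k → shift (m ∸ k) (P (suc k))) G₀) (λ _ → refl) ⟨
        Wp -ˢ Wq ∎
      P-split : ((P m +ˢ 0ˢ -ˢ W (λ k → shift (m ∸ k) (P (suc k)))) *ˢ G₀) ≈ˢ (P m *ˢ G₀ -ˢ Wp)
      P-split j = *ˢ-distribʳ--ˢ (P m +ˢ 0ˢ) _ G₀ j ∙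
                        cong (_- Wp j) (*ˢ-congʳ G₀ (λ j → ℤP.+-identityʳ (P m j)) j)
      lemma : ∀ x y z u v → x - y - z - (u - v) ≡ x - u - (y + z - v)
      lemma = solve-∀

  solved : ∀ D → (∀ m → m ≤ D → Recurrence m) → ∀ j → j ≤ D → Solved j
  solved zero rec zero _ = solved-zero (rec 0 z≤n)
  solved (suc D) rec j j≤D with ℕP.m≤n⇒m<n∨m≡n j≤D
  ... | inj₁ j<sD = solved D (λ m m≤D → rec m (ℕP.m≤n⇒m≤1+n m≤D)) j (ℕP.≤-pred j<sD)
  ... | inj₂ refl = solved-suc D (rec (suc D) ℕP.≤-refl) (solved D (λ m m≤D → rec m (ℕP.m≤n⇒m≤1+n m≤D)))

-- The coefficients a and b as iterated differences of ℓ

prod : (ℕ → ℤ) → List ℕ → ℤ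
prod f xs = prodℤ (List.map f xs)

prod-applyUpTo-suc : (f : ℕ → ℤ) (g : ℕ → ℕ) (n : ℕ) → prod f (applyUpTo g (suc n)) ≡ prod f (applyUpTo g n) * f (g n)
prod-applyUpTo-suc f g zero = ℤP.*-identityʳ (f (g 0)) ∙ sym (ℤP.*-identityˡ (f (g 0)))
prod-applyUpTo-suc f g (suc n) =
  cong (_*_ (f (g 0))) (prod-applyUpTo-suc f (g ∘ suc) n) ∙ sym (ℤP.*-assoc (f (g 0)) _ _)

isOne : ℕ → ℤ
isOne 1 = + 1
isOne _ = + 0

m∸n≡1+m∸1+n : ∀ {m n} → n < m → m ∸ n ≡ suc (m ∸ suc n)
m∸n≡1+m∸1+n {suc m} {zero} _ = refl
m∸n≡1+m∸1+n {suc m} {suc n} (s≤s n<m) = m∸n≡1+m∸1+n n<m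

module Coefficients (ℓ : ℕ → ℕ) where

  ∇-term : ℕ → ℕ → ℕ → ℤ
  ∇-term c r i = + (r C i) * signPow i * + ℓ (c ℕ.+ i)

  ∇ : ℕ → ℕ → ℤ
  ∇ c r = ∑ (∇-term c r) (upTo (suc r))

  ∇-zero : ∀ c → ∇ c 0 ≡ + ℓ c
  ∇-zero c = ℤP.+-identityʳ _ ∙ (ℤP.*-identityˡ _ ∙ cong (+_ ∘ ℓ) (ℕP.+-identityʳ c))

  ∇-unfold : ∀ c r → ∇ c r ≡ ∇-term c r 0 + ∑ (∇-term c r ∘ suc) (upTo r)
  ∇-unfold c r = cong (_+_ (∇-term c r 0)) (∑-applyUpTo (∇-term c r) suc r)

  ∇-term-pascal : ∀ c r i → ∇-term c (suc r) (suc i) ≡ ∇-term c r (suc i) - ∇-term (suc c) r i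
  ∇-term-pascal c r i rewrite sym (nCk+nC[k+1]≡[n+1]C[k+1] r i) | ℕP.+-suc c i =
    cong (λ z → z * - signPow i * + ℓ (suc (c ℕ.+ i))) (ℤP.pos-+ (r C i) (r C suc i)) ∙
          lemma (+ (r C i)) (+ (r C suc i)) (signPow i) (+ ℓ (suc (c ℕ.+ i)))
    where lemma : ∀ x y s l → (x + y) * - s * l ≡ y * - s * l - x * s * l
          lemma = solve-∀

  ∇-pascal : ∀ c r → ∇ c (suc r) ≡ ∇ c r - ∇ (suc c) r
  ∇-pascal c r = begin
    ∇ c (suc r)
      ≡⟨ ∇-unfold c (suc r) ⟩
    ∇-term c r 0 + ∑ (∇-term c (suc r) ∘ suc) (upTo (suc r))
      ≡⟨ cong (_+_ (∇-term c r 0)) (∑-cong (upTo (suc r)) (∇-term-pascal c r)) ⟩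
    ∇-term c r 0 + ∑ (λ i → ∇-term c r (suc i) - ∇-term (suc c) r i) (upTo (suc r))
      ≡⟨ cong (_+_ (∇-term c r 0)) (∑-distrib-- (∇-term c r ∘ suc) (∇-term (suc c) r) (upTo (suc r))) ⟩
    ∇-term c r 0 + (∑ (∇-term c r ∘ suc) (upTo (suc r)) - ∇ (suc c) r)
      ≡⟨ cong (λ x → ∇-term c r 0 + (x - ∇ (suc c) r)) (∑-upTo-suc (∇-term c r ∘ suc) r) ⟩
    ∇-term c r 0 + (∑ (∇-term c r ∘ suc) (upTo r) + ∇-term c r (suc r) - ∇ (suc c) r)
      ≡⟨ cong (λ x → ∇-term c r 0 + (∑ (∇-term c r ∘ suc) (upTo r) + x - ∇ (suc c) r)) last-vanishes ⟩
    ∇-term c r 0 + (∑ (∇-term c r ∘ suc) (upTo r) + + 0 - ∇ (suc c) r)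
      ≡⟨ lemma (∇-term c r 0) _ (∇ (suc c) r) ⟩
    (∇-term c r 0 + ∑ (∇-term c r ∘ suc) (upTo r)) - ∇ (suc c) r
      ≡⟨ cong (_- ∇ (suc c) r) (∇-unfold c r) ⟨
    ∇ c r - ∇ (suc c) r
      ∎
    where
    open ≡-Reasoning
    last-vanishes : ∇-term c r (suc r) ≡ + 0
    last-vanishes rewrite k>n⇒nCk≡0 (ℕP.n<1+n r) = refl
    lemma : ∀ x y z → x + (y + + 0 - z) ≡ (x + y) - z
    lemma = solve-∀

  -- F b m j is the number of vertices of Lk B ∖ S with exactly j neighbours in S, whenever B and S
  -- are disjoint, B ∪ S is a clique, |B| = b and |S| = m (layerCount); the recursion removes one
  -- vertex of S.
  F : ℕ → ℕ → ℕ → ℤ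
  F b zero    zero    = + ℓ b
  F b zero    (suc j) = + 0
  F b (suc m) zero    = F b m 0 - F (suc b) m 0 - + ι (m ≡ᵇ 0)
  F b (suc m) (suc j) = F (suc b) m j + F b m (suc j) - F (suc b) m (suc j) - + ι (m ≡ᵇ suc j)

  F-above : ∀ m b j → m < j → F b m j ≡ + 0
  F-above zero b (suc j) _ = refl
  F-above (suc m) b (suc j) (s≤s m<j)
    rewrite F-above m (suc b) j m<j | F-above m b (suc j) (ℕP.m<n⇒m<1+n m<j)
          | F-above m (suc b) (suc j) (ℕP.m<n⇒m<1+n m<j)
          | dec-false (m ℕP.≟ suc j) (ℕP.<⇒≢ (ℕP.m<n⇒m<1+n m<j)) = refl

  F-diagonal : ∀ m b → F b m m ≡ + ℓ (b ℕ.+ m)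
  F-diagonal zero b = cong (+_ ∘ ℓ) (sym (ℕP.+-identityʳ b))
  F-diagonal (suc m) b
    rewrite F-diagonal m (suc b) | F-above m b (suc m) ℕP.≤-refl | F-above m (suc b) (suc m) ℕP.≤-refl
          | dec-false (m ℕP.≟ suc m) (ℕP.<⇒≢ ℕP.≤-refl) | ℕP.+-suc b m = lemma (+ ℓ (suc (b ℕ.+ m)))
    where lemma : ∀ x → x + + 0 - + 0 - + 0 ≡ x
          lemma = solve-∀

  private
    ι-≡ᵇ-zero : ∀ m → + ι (m ≡ᵇ 0) ≡ isOne (suc m)
    ι-≡ᵇ-zero zero = refl
    ι-≡ᵇ-zero (suc m) = refl

    ι-≡ᵇ-suc : ∀ m j → j < m → + ι (m ≡ᵇ suc j) ≡ isOne (m ∸ j)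
    ι-≡ᵇ-suc (suc zero) zero _ = refl
    ι-≡ᵇ-suc (suc (suc m)) zero _ = refl
    ι-≡ᵇ-suc (suc m) (suc j) (s≤s j<m) = ι-≡ᵇ-suc m j j<m

    C-isOne : ∀ m j → j < m → + (m C suc j) * isOne (m ∸ j) ≡ isOne (m ∸ j)
    C-isOne m j j<m with ℕP.m≤n⇒m<n∨m≡n j<m
    ... | inj₂ refl rewrite nCn≡1 (suc j) = ℤP.*-identityˡ _
    ... | inj₁ sj<m = cong (λ t → + (m C suc j) * isOne t) m∸j≥2 ∙
                            (ℤP.*-zeroʳ (+ (m C suc j)) ∙ cong isOne (sym m∸j≥2))
      where m∸j≥2 : m ∸ j ≡ suc (suc (m ∸ suc (suc j)))
            m∸j≥2 = m∸n≡1+m∸1+n j<m ∙ cong suc (m∸n≡1+m∸1+n sj<m)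

  F-closed : ∀ m b j → j ≤ m → F b m j ≡ + (m C j) * (∇ (b ℕ.+ j) (m ∸ j) - isOne (m ∸ j))
  F-closed zero b zero _ = sym (ℤP.*-identityˡ _ ∙ (ℤP.+-identityʳ _ ∙ (∇-zero (b ℕ.+ 0) ∙ cong (+_ ∘ ℓ) (ℕP.+-identityʳ b))))
  F-closed (suc m) b zero _
    rewrite F-closed m b 0 z≤n | F-closed m (suc b) 0 z≤n | ℕP.+-identityʳ b | ∇-pascal b m | ι-≡ᵇ-zero m
    = lemma (∇ b m) (∇ (suc b) m) (isOne m) (isOne (suc m))
    where
    lemma : ∀ x y o i → + 1 * (x - o) - + 1 * (y - o) - i ≡ + 1 * (x - y - i)
    lemma = solve-∀
  F-closed (suc m) b (suc j) (s≤s j≤m) with ℕP.m≤n⇒m<n∨m≡n j≤m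
  ... | inj₂ refl rewrite F-diagonal (suc j) b | nCn≡1 (suc j) | ℕP.n∸n≡0 j | ∇-zero (b ℕ.+ suc j) =
    sym (ℤP.*-identityˡ _ ∙ ℤP.+-identityʳ _)
  ... | inj₁ j<m = begin
      F (suc b) m j + F b m (suc j) - F (suc b) m (suc j) - + ι (m ≡ᵇ suc j)
        ≡⟨ cong₂ (λ x y → x + y - F (suc b) m (suc j) - + ι (m ≡ᵇ suc j)) IH₁ IH₂ ⟩
      κ * (∇ c (m ∸ j) - O) + κ′ * (X - o) - F (suc b) m (suc j) - + ι (m ≡ᵇ suc j)
        ≡⟨ cong₂ (λ x y → κ * (∇ c (m ∸ j) - O) + κ′ * (X - o) - x - y) IH₃ (ι-≡ᵇ-suc m j j<m ∙ sym (C-isOne m j j<m)) ⟩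
      κ * (∇ c (m ∸ j) - O) + κ′ * (X - o) - κ′ * (Y - o) - κ′ * O
        ≡⟨ cong (λ t → κ * (t - O) + κ′ * (X - o) - κ′ * (Y - o) - κ′ * O) ∇-split ⟩
      κ * (X - Y - O) + κ′ * (X - o) - κ′ * (Y - o) - κ′ * O
        ≡⟨ lemma κ κ′ X Y O o ⟩
      (κ + κ′) * (X - Y - O)
        ≡⟨ cong₂ (λ x t → x * (t - O)) (sym (ℤP.pos-+ (m C j) (m C suc j)) ∙ cong +_ (nCk+nC[k+1]≡[n+1]C[k+1] m j)) (sym ∇-split) ⟩
      + (suc m C suc j) * (∇ c (m ∸ j) - O)
        ≡⟨ cong (λ c′ → + (suc m C suc j) * (∇ c′ (m ∸ j) - O)) (sym (ℕP.+-suc b j)) ⟩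
      + (suc m C suc j) * (∇ (b ℕ.+ suc j) (m ∸ j) - O)
        ∎
    where
    open ≡-Reasoning
    c = suc (b ℕ.+ j)
    r = m ∸ suc j
    κ = + (m C j)
    κ′ = + (m C suc j)
    O = isOne (m ∸ j)
    o = isOne r
    X = ∇ c r
    Y = ∇ (suc c) r
    ∇-split : ∇ c (m ∸ j) ≡ X - Y
    ∇-split = cong (∇ c) (m∸n≡1+m∸1+n j<m) ∙ ∇-pascal c r
    IH₁ : F (suc b) m j ≡ κ * (∇ c (m ∸ j) - O)
    IH₁ = F-closed m (suc b) j (ℕP.<⇒≤ j<m)
    IH₂ : F b m (suc j) ≡ κ′ * (X - o)
    IH₂ = F-closed m b (suc j) j<m ∙ cong (λ c′ → κ′ * (∇ c′ r - o)) (ℕP.+-suc b j)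
    IH₃ : F (suc b) m (suc j) ≡ κ′ * (Y - o)
    IH₃ = F-closed m (suc b) (suc j) j<m ∙ cong (λ c′ → κ′ * (∇ (suc c′) r - o)) (ℕP.+-suc b j)
    lemma : ∀ x y u v w t → x * (u - v - w) + y * (u - t) - y * (v - t) - y * w ≡ (x + y) * (u - v - w)
    lemma = solve-∀

  ∇-one : ∀ c → ∇ c 1 ≡ + ℓ c - + ℓ (suc c)
  ∇-one c = cong₂ (λ x y → + 1 * + 1 * + ℓ x + (+ 1 * - + 1 * + ℓ y + + 0)) (ℕP.+-identityʳ c) (ℕP.+-comm c 1) ∙
                  lemma (+ ℓ c) (+ ℓ (suc c))
    where lemma : ∀ x y → + 1 * + 1 * x + (+ 1 * - + 1 * y + + 0) ≡ x - y
          lemma = solve-∀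

  N≡prod*∇ : ∀ m k → k < m → N ℓ m k ≡ prod (λ i → + ℓ (suc k ℕ.+ i)) (upTo (m ∸ k ∸ 1)) * (∇ k (m ∸ k) - isOne (m ∸ k))
  N≡prod*∇ m k k<m with m ∸ k in e
  ... | suc zero = begin
      + ℓ (m ∸ 1) - + ℓ m - + 1       ≡⟨ cong₂ (λ x y → + ℓ x - + ℓ y - + 1) (cong (_∸ 1) m≡1+k) m≡1+k ⟩
      + ℓ k - + ℓ (suc k) - + 1       ≡⟨ cong (_- + 1) (∇-one k) ⟨
      ∇ k 1 - + 1                     ≡⟨ ℤP.*-identityˡ _ ⟨
      + 1 * (∇ k 1 - + 1)             ∎
    where open ≡-Reasoning
          m≡1+k : m ≡ suc k
          m≡1+k = sym (ℕP.m+[n∸m]≡n (ℕP.<⇒≤ k<m)) ∙ (cong (k ℕ.+_) e ∙ ℕP.+-comm k 1)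
  ... | suc (suc t) = cong (λ r → Π (r ∸ 1) * ∇ k r) e ∙ cong (Π (suc t) *_) (sym (ℤP.+-identityʳ (∇ k (suc (suc t)))))
    where Π : ℕ → ℤ
          Π r = prod (λ i → + ℓ (suc k ℕ.+ i)) (upTo r)
  N≡prod*∇ (suc m) k k<m | zero = contradiction e (ℕP.m>n⇒m∸n≢0 k<m)
    where open import Relation.Nullary using (contradiction)

  a-+ : ∀ c t → a ℓ (c ℕ.+ t) ≡ a ℓ c * prod (λ i → + ℓ (c ℕ.+ i)) (upTo t)
  a-+ c zero = cong (a ℓ) (ℕP.+-identityʳ c) ∙ sym (ℤP.*-identityʳ _)
  a-+ c (suc t) = begin
    a ℓ (c ℕ.+ suc t)                                                  ≡⟨ cong (a ℓ) (ℕP.+-suc c t) ⟩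
    a ℓ (c ℕ.+ t) * + ℓ (c ℕ.+ t)                                      ≡⟨ cong (_* + ℓ (c ℕ.+ t)) (a-+ c t) ⟩
    a ℓ c * prod (λ i → + ℓ (c ℕ.+ i)) (upTo t) * + ℓ (c ℕ.+ t)        ≡⟨ ℤP.*-assoc (a ℓ c) _ _ ⟩
    a ℓ c * (prod (λ i → + ℓ (c ℕ.+ i)) (upTo t) * + ℓ (c ℕ.+ t))      ≡⟨ cong (a ℓ c *_) (prod-applyUpTo-suc (λ i → + ℓ (c ℕ.+ i)) (λ x → x) t) ⟨
    a ℓ c * prod (λ i → + ℓ (c ℕ.+ i)) (upTo (suc t))                  ∎
    where open ≡-Reasoning

  a*F≡b*a : ∀ m j → j < m → a ℓ m * F 0 m j ≡ b ℓ m j * a ℓ (suc j)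
  a*F≡b*a m j j<m = begin
    a ℓ m * F 0 m j                                       ≡⟨ cong (λ x → a ℓ x * F 0 m j) (ℕP.m+[n∸m]≡n j<m) ⟨
    a ℓ (suc j ℕ.+ r) * F 0 m j                           ≡⟨ cong (_* F 0 m j) (a-+ (suc j) r) ⟩
    a ℓ (suc j) * Π r * F 0 m j                           ≡⟨ cong (a ℓ (suc j) * Π r *_) (F-closed m 0 j (ℕP.<⇒≤ j<m)) ⟩
    a ℓ (suc j) * Π r * (+ (m C j) * (∇ j (m ∸ j) - isOne (m ∸ j)))
        ≡⟨ lemma (a ℓ (suc j)) (Π r) (+ (m C j)) (∇ j (m ∸ j) - isOne (m ∸ j)) ⟩
    + (m C j) * (Π r * (∇ j (m ∸ j) - isOne (m ∸ j))) * a ℓ (suc j)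
        ≡⟨ cong (λ t → + (m C j) * (Π t * (∇ j (m ∸ j) - isOne (m ∸ j))) * a ℓ (suc j)) (cong (_∸ 1) (m∸n≡1+m∸1+n j<m)) ⟨
    + (m C j) * (Π (m ∸ j ∸ 1) * (∇ j (m ∸ j) - isOne (m ∸ j))) * a ℓ (suc j)
        ≡⟨ cong (λ x → + (m C j) * x * a ℓ (suc j)) (N≡prod*∇ m j j<m) ⟨
    b ℓ m j * a ℓ (suc j)                                 ∎
    where
    open ≡-Reasoning
    r = m ∸ suc j
    Π : ℕ → ℤ
    Π t = prod (λ i → + ℓ (suc j ℕ.+ i)) (upTo t)
    lemma : ∀ x y c d → x * y * (c * d) ≡ c * (y * d) * x
    lemma = solve-∀

  a*F-diagonal : ∀ m → a ℓ m * F 0 m m ≡ a ℓ (suc m)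
  a*F-diagonal m = cong (a ℓ m *_) (F-diagonal m 0)

-- Counting vertices

count : ∀ {n} → (Fin n → Bool) → ℕ
count P = ℕΣ.sum (ι ∘ P)

module _ {n : ℕ} where

  count-cong : {P Q : Fin n → Bool} → (∀ v → P v ≡ Q v) → count P ≡ count Q
  count-cong e = ℕΣ.sum-cong-≗ (cong ι ∘ e)

  count-false : (P : Fin n → Bool) → (∀ v → P v ≡ false) → count P ≡ 0
  count-false P e = ℕΣ.sum-cong-≗ (cong ι ∘ e) ∙ ℕΣ.sum-replicate-zero n

count-∅ : ∀ n → count {n} (λ _ → false) ≡ 0
count-∅ n = count-false {n} (λ _ → false) (λ _ → refl)

count-zero : ∀ {n} (P : Fin n → Bool) → count P ≡ 0 → ∀ v → P v ≡ false
count-zero {suc n} P e v with P Fin.zero in P0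
count-zero {suc n} P () v | true
count-zero {suc n} P e Fin.zero | false = P0
count-zero {suc n} P e (Fin.suc v) | false = count-zero (P ∘ Fin.suc) e v

count-suc : ∀ {n} (P : Fin n → Bool) {k} → count P ≡ suc k → Σ (Fin n) λ v → P v ≡ true
count-suc {suc n} P e with P Fin.zero in P0
... | true = Fin.zero , P0
... | false with count-suc (P ∘ Fin.suc) e
... | v , Pv = Fin.suc v , Pv

count-point : ∀ {n} (w : Fin n) (b : Bool) → count (λ v → does (v ≟ w) ∧ b) ≡ ι b
count-point {suc n} Fin.zero b = cong (ι b ℕ.+_) (count-∅ n) ∙ ℕP.+-identityʳ (ι b)
count-point {suc n} (Fin.suc w) b = count-point w b

count-mono : ∀ {n} (P Q : Fin n → Bool) → (∀ v → P v ≡ true → Q v ≡ true) → count P ≤ count Q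
count-mono {zero} P Q h = z≤n
count-mono {suc n} P Q h = ℕP.+-mono-≤ (ι-mono (P Fin.zero) (Q Fin.zero) (h Fin.zero)) (count-mono (P ∘ Fin.suc) (Q ∘ Fin.suc) (h ∘ Fin.suc))
  where ι-mono : ∀ a b → (a ≡ true → b ≡ true) → ι a ≤ ι b
        ι-mono false b h = z≤n
        ι-mono true b h rewrite h refl = ℕP.≤-refl

∣∣≡count : ∀ {n} (σ : Subset n) → ∣ σ ∣ ≡ count (lookup σ)
∣∣≡count Vec.[] = refl
∣∣≡count (true Vec.∷ σ) = cong suc (∣∣≡count σ)
∣∣≡count (false Vec.∷ σ) = ∣∣≡count σ

count-tabulate : ∀ {n} (P : Fin n → Bool) → ∣ tabulate P ∣ ≡ count P
count-tabulate P = ∣∣≡count (tabulate P) ∙ count-cong (lookup∘tabulate P)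

count-split-point : ∀ {n} (w : Fin n) (P : Fin n → Bool) → count P ≡ ι (P w) ℕ.+ count (λ v → P v ∧ not (does (v ≟ w)))
count-split-point {suc n} Fin.zero P = cong (ι (P Fin.zero) ℕ.+_) (begin
  count (P ∘ Fin.suc)                                  ≡⟨ count-cong (λ v → sym (∧-identityʳ (P (Fin.suc v)))) ⟩
  count (λ v → P (Fin.suc v) ∧ true)                   ≡⟨ cong (λ b → ι b ℕ.+ count (λ v → P (Fin.suc v) ∧ true)) (∧-zeroʳ (P Fin.zero)) ⟨
  ι (P Fin.zero ∧ false) ℕ.+ count (λ v → P (Fin.suc v) ∧ true) ∎)
  where open ≡-Reasoning
count-split-point {suc n} (Fin.suc w) P = begin
  ι (P Fin.zero) ℕ.+ count (P ∘ Fin.suc)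
    ≡⟨ cong (ι (P Fin.zero) ℕ.+_) (count-split-point w (P ∘ Fin.suc)) ⟩
  ι (P Fin.zero) ℕ.+ (ι (P (Fin.suc w)) ℕ.+ rest)
    ≡⟨ ℕP.+-assoc (ι (P Fin.zero)) _ rest ⟨
  ι (P Fin.zero) ℕ.+ ι (P (Fin.suc w)) ℕ.+ rest
    ≡⟨ cong (ℕ._+ rest) (ℕP.+-comm (ι (P Fin.zero)) _) ⟩
  ι (P (Fin.suc w)) ℕ.+ ι (P Fin.zero) ℕ.+ rest
    ≡⟨ ℕP.+-assoc (ι (P (Fin.suc w))) _ rest ⟩
  ι (P (Fin.suc w)) ℕ.+ (ι (P Fin.zero) ℕ.+ rest)
    ≡⟨ cong (λ b → ι (P (Fin.suc w)) ℕ.+ (ι b ℕ.+ rest)) (∧-identityʳ (P Fin.zero)) ⟨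
  ι (P (Fin.suc w)) ℕ.+ (ι (P Fin.zero ∧ true) ℕ.+ rest)
    ∎
  where open ≡-Reasoning
        rest = count (λ v → P (Fin.suc v) ∧ not (does (v ≟ w)))

∑-ι-allFin : ∀ {n} (P : Fin n → Bool) → ∑ (λ v → + ι (P v)) (allFin n) ≡ + count P
∑-ι-allFin {zero} P = refl
∑-ι-allFin {suc n} P = ∑-allFin-suc (λ v → + ι (P v)) ∙
  (cong (_+_ (+ ι (P Fin.zero))) (∑-ι-allFin (P ∘ Fin.suc)) ∙ sym (ℤP.pos-+ (ι (P Fin.zero)) _))

∑-if-allFin : ∀ {n} (P : Fin n → Bool) {c : ℤ} → ∑ (λ v → if P v then c else + 0) (allFin n) ≡ + count P * c
∑-if-allFin {n} P {c} = ∑-if P (allFin n) ∙ cong (_* c) (+length-filter P (allFin n) ∙ ∑-ι-allFin P)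

∑-levels : ∀ {n} (P : Fin n → Bool) (g : Fin n → ℕ) (h : ℕ → ℤ) (m : ℕ) → (∀ v → g v ≤ m)
  → ∑ (λ v → if P v then + 0 else h (g v)) (allFin n) ≡ ∑ (λ j → + count (λ v → not (P v) ∧ (g v ≡ᵇ j)) * h j) (upTo (suc m))
∑-levels {n} P g h m bounded = begin
  ∑ (λ v → if P v then + 0 else h (g v)) (allFin n)
    ≡⟨ ∑-cong (allFin n) spread ⟩
  ∑ (λ v → ∑ (λ j → if not (P v) ∧ (g v ≡ᵇ j) then h j else + 0) (upTo (suc m))) (allFin n)
    ≡⟨ ∑-swap (λ v j → if not (P v) ∧ (g v ≡ᵇ j) then h j else + 0) (allFin n) (upTo (suc m)) ⟩
  ∑ (λ j → ∑ (λ v → if not (P v) ∧ (g v ≡ᵇ j) then h j else + 0) (allFin n)) (upTo (suc m))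
    ≡⟨ ∑-cong (upTo (suc m)) (λ j → ∑-if-allFin (λ v → not (P v) ∧ (g v ≡ᵇ j))) ⟩
  ∑ (λ j → + count (λ v → not (P v) ∧ (g v ≡ᵇ j)) * h j) (upTo (suc m))
    ∎
  where
  open ≡-Reasoning
  spread : ∀ v → (if P v then + 0 else h (g v)) ≡ ∑ (λ j → if not (P v) ∧ (g v ≡ᵇ j) then h j else + 0) (upTo (suc m))
  spread v with P v
  ... | true = sym (∑-zero (upTo (suc m)) (λ _ → refl))
  ... | false = sym (∑-upTo-δ m h (bounded v))

-- Cliques and links

allᵇ-tabulate⇒ : ∀ {m} (f : A → Bool) (g : Fin m → A) → allᵇ f (List.tabulate g) ≡ true → ∀ i → f (g i) ≡ true
allᵇ-tabulate⇒ f g e Fin.zero = proj₁ (∧-true e)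
allᵇ-tabulate⇒ f g e (Fin.suc i) = allᵇ-tabulate⇒ f (g ∘ Fin.suc) (proj₂ (∧-true e)) i

allᵇ-tabulate⇐ : ∀ {m} (f : A → Bool) (g : Fin m → A) → (∀ i → f (g i) ≡ true) → allᵇ f (List.tabulate g) ≡ true
allᵇ-tabulate⇐ {m = zero} f g h = refl
allᵇ-tabulate⇐ {m = suc m} f g h rewrite h Fin.zero = allᵇ-tabulate⇐ f (g ∘ Fin.suc) (h ∘ Fin.suc)

lookup-⁅⁆ : ∀ {n} (w u : Fin n) → lookup ⁅ w ⁆ u ≡ does (u ≟ w)
lookup-⁅⁆ Fin.zero Fin.zero = refl
lookup-⁅⁆ Fin.zero (Fin.suc u) = lookup-replicate u false
lookup-⁅⁆ (Fin.suc w) Fin.zero = refl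
lookup-⁅⁆ (Fin.suc w) (Fin.suc u) = lookup-⁅⁆ w u

lookup-∪ : ∀ {n} (σ τ : Subset n) u → lookup (σ ∪ τ) u ≡ lookup σ u ∨ lookup τ u
lookup-∪ σ τ u = lookup-zipWith _∨_ u σ τ

lookup-∩ : ∀ {n} (σ τ : Subset n) u → lookup (σ ∩ τ) u ≡ lookup σ u ∧ lookup τ u
lookup-∩ σ τ u = lookup-zipWith _∧_ u σ τ

lookup-⊥ : ∀ {n} (u : Fin n) → lookup (⊥ {n}) u ≡ false
lookup-⊥ u = lookup-replicate u false

module Cliques {n : ℕ} (E : Adj n) (E-sym : ∀ u v → E u v ≡ E v u) where

  IsCliqueᵖ : (Fin n → Bool) → Set
  IsCliqueᵖ S = ∀ u v → S u ≡ true → S v ≡ true → u ≢ v → E u v ≡ true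

  IsCliqueᵖ-⊆ : {P Q : Fin n → Bool} → (∀ u → P u ≡ true → Q u ≡ true) → IsCliqueᵖ Q → IsCliqueᵖ P
  IsCliqueᵖ-⊆ h c u v pu pv = c u v (h u pu) (h v pv)

  isClique⇒ : (σ : Subset n) → IsClique E σ → IsCliqueᵖ (lookup σ)
  isClique⇒ σ e u v σu σv u≢v with allᵇ-tabulate⇒ _ (λ x → x) (allᵇ-tabulate⇒ _ (λ x → x) e u) v
  ... | uv rewrite σu | σv | dec-false (u ≟ v) u≢v = uv

  isClique⇐ : (σ : Subset n) → IsCliqueᵖ (lookup σ) → IsClique E σ
  isClique⇐ σ c = allᵇ-tabulate⇐ _ (λ x → x) (λ u → allᵇ-tabulate⇐ _ (λ x → x) (λ v → pair u v))
    where
    pair : ∀ u v → not (lookup σ u ∧ lookup σ v ∧ (u ≠ᵇ v)) ∨ E u v ≡ true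
    pair u v with lookup σ u in σu | lookup σ v in σv | u ≟ v
    ... | false | _ | _ = refl
    ... | true | false | _ = refl
    ... | true | true | yes _ = refl
    ... | true | true | no u≢v = c u v σu σv u≢v

  lk : (Fin n → Bool) → Fin n → Bool
  lk B = lookup (Lk E (tabulate B))

  lk-spec : (B : Fin n → Bool) (v : Fin n) → lk B v ≡ not (B v) ∧ isCliqueᵇ E (tabulate B ∪ ⁅ v ⁆)
  lk-spec B v = lookup∘tabulate _ v ∙ cong (λ b → not b ∧ isCliqueᵇ E (tabulate B ∪ ⁅ v ⁆)) (lookup∘tabulate B v)

  lookup-tabulate-∪-⁅⁆ : (B : Fin n → Bool) (v u : Fin n) → lookup (tabulate B ∪ ⁅ v ⁆) u ≡ B u ∨ does (u ≟ v)
  lookup-tabulate-∪-⁅⁆ B v u = lookup-∪ (tabulate B) ⁅ v ⁆ u ∙ cong₂ _∨_ (lookup∘tabulate B u) (lookup-⁅⁆ v u)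

  lk⇒ : (B : Fin n → Bool) (v : Fin n) → lk B v ≡ true → B v ≡ false × (∀ u → B u ≡ true → E u v ≡ true)
  lk⇒ B v e = Bv , adjacent
    where
    parts = ∧-true (sym (lk-spec B v) ∙ e)
    Bv = not-true (proj₁ parts)
    clique = isClique⇒ (tabulate B ∪ ⁅ v ⁆) (proj₂ parts)
    adjacent : ∀ u → B u ≡ true → E u v ≡ true
    adjacent u Bu = clique u v
      (lookup-tabulate-∪-⁅⁆ B v u ∙ cong (_∨ does (u ≟ v)) Bu)
      (lookup-tabulate-∪-⁅⁆ B v v ∙ (cong (B v ∨_) (dec-true (v ≟ v) refl) ∙ ∨-zeroʳ (B v)))
      (λ u≡v → true≢false (sym Bu ∙ (cong B u≡v ∙ Bv)))

  lk⇐ : (B : Fin n → Bool) → IsCliqueᵖ B → (v : Fin n) → B v ≡ false → (∀ u → B u ≡ true → E u v ≡ true) → lk B v ≡ true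
  lk⇐ B c v Bv adjacent = lk-spec B v ∙ cong₂ _∧_ (cong not Bv) (isClique⇐ (tabulate B ∪ ⁅ v ⁆) clique)
    where
    member : ∀ u → lookup (tabulate B ∪ ⁅ v ⁆) u ≡ true → B u ≡ true ⊎ u ≡ v
    member u e with ∨-true (B u) (sym (lookup-tabulate-∪-⁅⁆ B v u) ∙ e)
    ... | inj₁ Bu = inj₁ Bu
    ... | inj₂ u≡v = inj₂ (does-≟-true u≡v)
    clique : IsCliqueᵖ (lookup (tabulate B ∪ ⁅ v ⁆))
    clique u w eu ew u≢w with member u eu | member w ew
    ... | inj₁ Bu | inj₁ Bw = c u w Bu Bw u≢w
    ... | inj₁ Bu | inj₂ refl = adjacent u Bu
    ... | inj₂ refl | inj₁ Bw = E-sym u w ∙ adjacent w Bw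
    ... | inj₂ refl | inj₂ refl = ⊥-elim (u≢w refl)

previous : (ℕ → Bool) → ℕ → Bool
previous f zero = false
previous f (suc j) = f j

previous-cong : {f g : ℕ → Bool} → (∀ i → f i ≡ g i) → ∀ j → previous f j ≡ previous g j
previous-cong e zero = refl
previous-cong e (suc j) = e j

-- The peeling identity at a vertex v ≠ w, with L = [v ∈ Lk B], s = [v ∈ S′], e = [v ~ w] and
-- z = |N(v) ∩ S′|.
layer-identity : ∀ (L s e : Bool) (z j : ℕ) →
  ι (L ∧ (not s ∧ ((ι e ℕ.+ z) ≡ᵇ j))) ℕ.+ ι ((L ∧ e) ∧ (not s ∧ (z ≡ᵇ j))) ℕ.+ 0
  ≡ ι (previous (λ i → (L ∧ e) ∧ (not s ∧ (z ≡ᵇ i))) j) ℕ.+ ι (L ∧ (not s ∧ (z ≡ᵇ j)))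
layer-identity false s e z zero = refl
layer-identity false s e z (suc j) = refl
layer-identity true true e z zero rewrite ∧-zeroʳ e = refl
layer-identity true true e z (suc j) rewrite ∧-zeroʳ e = refl
layer-identity true false true z zero = ℕP.+-identityʳ _
layer-identity true false true z (suc j) = ℕP.+-identityʳ _
layer-identity true false false z zero = ℕP.+-identityʳ _ ∙ ℕP.+-identityʳ _
layer-identity true false false z (suc j) = ℕP.+-identityʳ _ ∙ ℕP.+-identityʳ _

ℕ-identity⇒ℤ : ∀ a r i c q → a ℕ.+ r ℕ.+ i ≡ c ℕ.+ q → + a ≡ + c + + q - + r - + i
ℕ-identity⇒ℤ a r i c q eq = begin
  + a                                ≡⟨ lemma (+ a) (+ r) (+ i) ⟩
  (+ a + + r + + i) - + r - + i      ≡⟨ cong (λ x → x - + r - + i) (cong (_+ + i) (sym (ℤP.pos-+ a r)) ∙ sym (ℤP.pos-+ (a ℕ.+ r) i)) ⟩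
  + (a ℕ.+ r ℕ.+ i) - + r - + i      ≡⟨ cong (λ x → + x - + r - + i) eq ⟩
  + (c ℕ.+ q) - + r - + i            ≡⟨ cong (λ x → x - + r - + i) (ℤP.pos-+ c q) ⟩
  + c + + q - + r - + i              ∎
  where open ≡-Reasoning
        lemma : ∀ x y z → x ≡ x + y + z - y - z
        lemma = solve-∀

module Layers {n : ℕ} (E : Adj n) (E-sym : ∀ u v → E u v ≡ E v u)
              (ℓ : ℕ → ℕ) (regular : ∀ σ → IsClique E σ → ∣ Lk E σ ∣ ≡ ℓ ∣ σ ∣) where

  open Cliques E E-sym
  open Coefficients ℓ

  count-lk : (B : Fin n → Bool) → IsCliqueᵖ B → count (lk B) ≡ ℓ (count B)
  count-lk B c = begin
    count (lk B)               ≡⟨ ∣∣≡count (Lk E (tabulate B)) ⟨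
    ∣ Lk E (tabulate B) ∣      ≡⟨ regular (tabulate B) (isClique⇐ (tabulate B) (IsCliqueᵖ-⊆ (λ u e → sym (lookup∘tabulate B u) ∙ e) c)) ⟩
    ℓ ∣ tabulate B ∣           ≡⟨ cong ℓ (count-tabulate B) ⟩
    ℓ (count B)                ∎
    where open ≡-Reasoning

  deg : (Fin n → Bool) → Fin n → ℕ
  deg S v = count (λ u → E v u ∧ S u)

  layer : (B S : Fin n → Bool) → ℕ → Fin n → Bool
  layer B S j v = lk B v ∧ (not (S v) ∧ (deg S v ≡ᵇ j))

  Disjoint : (B S : Fin n → Bool) → Set
  Disjoint B S = ∀ v → B v ≡ true → S v ≡ false

  layer-empty : ∀ {S} → count S ≡ 0 → ∀ B j v → layer B S j v ≡ lk B v ∧ (0 ≡ᵇ j)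
  layer-empty {S} S-empty B j v = cong₂ (λ s d → lk B v ∧ (not s ∧ (d ≡ᵇ j))) (S-false v)
    (count-false (λ u → E v u ∧ S u) (λ u → cong (E v u ∧_) (S-false u) ∙ ∧-zeroʳ (E v u)))
    where S-false = count-zero S S-empty

  LayerCount : ℕ → Set
  LayerCount m = ∀ B S → count S ≡ m → IsCliqueᵖ (λ u → B u ∨ S u) → Disjoint B S
    → ∀ j → + count (layer B S j) ≡ F (count B) m j

  layerCount-zero : LayerCount 0
  layerCount-zero B S S-empty clique _ zero =
    cong +_ (count-cong (λ v → layer≡ 0 v ∙ ∧-identityʳ (lk B v)) ∙ count-lk B B-clique)
    where
    B-clique = IsCliqueᵖ-⊆ (λ u Bu → cong (_∨ S u) Bu) clique
    layer≡ = λ j v → layer-empty S-empty B j v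
  layerCount-zero B S S-empty clique _ (suc j) =
    cong +_ (count-cong (λ v → layer-empty S-empty B (suc j) v ∙ ∧-zeroʳ (lk B v)) ∙ count-∅ n)

  module Peel (B S : Fin n → Bool) (w : Fin n) (Sw : S w ≡ true)
              (clique : IsCliqueᵖ (λ u → B u ∨ S u)) (disjoint : Disjoint B S) where

    isw : Fin n → Bool
    isw v = does (v ≟ w)

    S′ B′ : Fin n → Bool
    S′ v = S v ∧ not (isw v)
    B′ v = B v ∨ isw v

    isw-w : isw w ≡ true
    isw-w = dec-true (w ≟ w) refl

    Bw : B w ≡ false
    Bw with B w in Bw
    ... | false = refl
    ... | true = ⊥-elim (true≢false (sym Sw ∙ disjoint w Bw))

    S′-≢ : ∀ {v} → v ≢ w → S′ v ≡ S v
    S′-≢ {v} v≢w = cong (λ b → S v ∧ not b) (dec-false (v ≟ w) v≢w) ∙ ∧-identityʳ (S v)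

    S′-w : S′ w ≡ false
    S′-w = cong (λ b → S w ∧ not b) isw-w ∙ ∧-zeroʳ (S w)

    isw⇒≡ : ∀ {v} → isw v ≡ true → v ≡ w
    isw⇒≡ = does-≟-true

    B′S′⊆BS : ∀ u → (B′ u ∨ S′ u) ≡ true → (B u ∨ S u) ≡ true
    B′S′⊆BS u e with ∨-true (B′ u) e
    ... | inj₂ S′u = cong (B u ∨_) (proj₁ (∧-true S′u)) ∙ ∨-zeroʳ (B u)
    ... | inj₁ B′u with ∨-true (B u) B′u
    ...   | inj₁ Bu = cong (_∨ S u) Bu
    ...   | inj₂ iswu = cong (B u ∨_) (cong S (isw⇒≡ iswu) ∙ Sw) ∙ ∨-zeroʳ (B u)

    B′S′-clique : IsCliqueᵖ (λ u → B′ u ∨ S′ u)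
    B′S′-clique = IsCliqueᵖ-⊆ B′S′⊆BS clique

    B′-clique : IsCliqueᵖ B′
    B′-clique = IsCliqueᵖ-⊆ (λ u B′u → cong (_∨ S′ u) B′u) B′S′-clique

    B-clique : IsCliqueᵖ B
    B-clique = IsCliqueᵖ-⊆ (λ u Bu → cong (_∨ isw u) Bu) B′-clique

    BS′-clique : IsCliqueᵖ (λ u → B u ∨ S′ u)
    BS′-clique = IsCliqueᵖ-⊆ widen B′S′-clique
      where widen : ∀ u → (B u ∨ S′ u) ≡ true → (B′ u ∨ S′ u) ≡ true
            widen u e with ∨-true (B u) e
            ... | inj₁ Bu = cong (λ b → (b ∨ isw u) ∨ S′ u) Bu
            ... | inj₂ S′u = cong (B′ u ∨_) S′u ∙ ∨-zeroʳ (B′ u)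

    BS′-disjoint : Disjoint B S′
    BS′-disjoint v Bv = cong (_∧ not (isw v)) (disjoint v Bv)

    B′S′-disjoint : Disjoint B′ S′
    B′S′-disjoint v B′v with ∨-true (B v) B′v
    ... | inj₁ Bv = BS′-disjoint v Bv
    ... | inj₂ iswv = cong S′ (isw⇒≡ iswv) ∙ S′-w

    count-S : count S ≡ suc (count S′)
    count-S = count-split-point w S ∙ cong (λ b → ι b ℕ.+ count S′) Sw

    count-B′ : count B′ ≡ suc (count B)
    count-B′ = count-split-point w B′ ∙ cong₂ (λ b c → ι b ℕ.+ c) (cong (B w ∨_) isw-w ∙ ∨-zeroʳ (B w)) (count-cong B′-off-w)
      where B′-off-w : ∀ v → B′ v ∧ not (isw v) ≡ B v
            B′-off-w v with v ≟ w
            ... | yes refl = ∧-zeroʳ (B v ∨ true) ∙ sym Bw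
            ... | no _ = ∧-identityʳ (B v ∨ false) ∙ ∨-identityʳ (B v)

    deg-S : ∀ v → deg S v ≡ ι (E v w) ℕ.+ deg S′ v
    deg-S v = count-split-point w (λ u → E v u ∧ S u) ∙
      cong₂ ℕ._+_ (cong (λ b → ι (E v w ∧ b)) Sw ∙ cong ι (∧-identityʳ (E v w))) (count-cong (λ u → ∧-assoc (E v u) (S u) _))

    deg-S′-w : deg S′ w ≡ count S′
    deg-S′-w = count-cong adjacent
      where adjacent : ∀ u → E w u ∧ S′ u ≡ S′ u
            adjacent u with S′ u in S′u
            ... | false = ∧-zeroʳ (E w u)
            ... | true = ∧-identityʳ (E w u) ∙ clique w u (cong (B w ∨_) Sw ∙ ∨-zeroʳ (B w)) (cong (B u ∨_) (proj₁ (∧-true S′u)) ∙ ∨-zeroʳ (B u))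
                                 (λ w≡u → true≢false (sym S′u ∙ (cong S′ (sym w≡u) ∙ S′-w)))

    lk-B-w : lk B w ≡ true
    lk-B-w = lk⇐ B B-clique w Bw (λ u Bu → clique u w (cong (_∨ S u) Bu) (cong (B w ∨_) Sw ∙ ∨-zeroʳ (B w))
                                    (λ u≡w → true≢false (sym Bu ∙ (cong B u≡w ∙ Bw))))

    lk-B′-w : lk B′ w ≡ false
    lk-B′-w with lk B′ w in lk-w
    ... | false = refl
    ... | true = ⊥-elim (true≢false (sym (cong (B w ∨_) isw-w ∙ ∨-zeroʳ (B w)) ∙ proj₁ (lk⇒ B′ w lk-w)))

    lk-B′-≢ : ∀ {v} → v ≢ w → lk B′ v ≡ lk B v ∧ E v w
    lk-B′-≢ {v} v≢w = bool-ext to from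
      where
      to : lk B′ v ≡ true → lk B v ∧ E v w ≡ true
      to e with lk⇒ B′ v e
      ... | B′v , adjacent = cong₂ _∧_
        (lk⇐ B B-clique v (proj₁ (∨-false B′v)) (λ u Bu → adjacent u (cong (_∨ isw u) Bu)))
        (E-sym v w ∙ adjacent w (cong (B w ∨_) isw-w ∙ ∨-zeroʳ (B w)))
      from : lk B v ∧ E v w ≡ true → lk B′ v ≡ true
      from e = lk⇐ B′ B′-clique v (cong₂ _∨_ Bv (dec-false (v ≟ w) v≢w)) adjacent
        where
        parts = ∧-true e
        Bv = proj₁ (lk⇒ B v (proj₁ parts))
        adjacent : ∀ u → B′ u ≡ true → E u v ≡ true
        adjacent u B′u with ∨-true (B u) B′u
        ... | inj₁ Bu = proj₂ (lk⇒ B v (proj₁ parts)) u Bu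
        ... | inj₂ iswu = cong (λ x → E x v) (isw⇒≡ iswu) ∙ (E-sym w v ∙ proj₂ parts)

    layer-B′S′-≢ : ∀ {v} → v ≢ w → ∀ i → layer B′ S′ i v ≡ (lk B v ∧ E v w) ∧ (not (S′ v) ∧ (deg S′ v ≡ᵇ i))
    layer-B′S′-≢ {v} v≢w i = cong (_∧ (not (S′ v) ∧ (deg S′ v ≡ᵇ i))) (lk-B′-≢ v≢w)

    layer-BS-≢ : ∀ {v} → v ≢ w → ∀ j → layer B S j v ≡ lk B v ∧ (not (S′ v) ∧ ((ι (E v w) ℕ.+ deg S′ v) ≡ᵇ j))
    layer-BS-≢ {v} v≢w j = cong₂ (λ s d → lk B v ∧ (not s ∧ (d ≡ᵇ j))) (sym (S′-≢ v≢w)) (deg-S v)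

    layer-B′S′-w : ∀ i → layer B′ S′ i w ≡ false
    layer-B′S′-w i = cong (_∧ (not (S′ w) ∧ (deg S′ w ≡ᵇ i))) lk-B′-w

    layer-BS-w : ∀ j → layer B S j w ≡ false
    layer-BS-w j = cong (λ s → lk B w ∧ (not s ∧ (deg S w ≡ᵇ j))) Sw ∙ ∧-zeroʳ (lk B w)

    layer-BS′-w : ∀ j → layer B S′ j w ≡ (count S′ ≡ᵇ j)
    layer-BS′-w j = cong₂ (λ l s → l ∧ (not s ∧ (deg S′ w ≡ᵇ j))) lk-B-w S′-w ∙ cong (_≡ᵇ j) deg-S′-w

    previous-false : ∀ j → previous (λ _ → false) j ≡ false
    previous-false zero = refl
    previous-false (suc j) = refl

    layer-pointwise : ∀ j v → ι (layer B S j v) ℕ.+ ι (layer B′ S′ j v) ℕ.+ ι (isw v ∧ (count S′ ≡ᵇ j))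
                              ≡ ι (previous (λ i → layer B′ S′ i v) j) ℕ.+ ι (layer B S′ j v)
    layer-pointwise j v = at v (v ≟ w)
      where
      open ≡-Reasoning
      at : ∀ v → Dec (v ≡ w) → ι (layer B S j v) ℕ.+ ι (layer B′ S′ j v) ℕ.+ ι (isw v ∧ (count S′ ≡ᵇ j))
                                ≡ ι (previous (λ i → layer B′ S′ i v) j) ℕ.+ ι (layer B S′ j v)
      at v (yes refl) = begin
        ι (layer B S j v) ℕ.+ ι (layer B′ S′ j v) ℕ.+ ι (isw v ∧ (count S′ ≡ᵇ j))
          ≡⟨ cong₂ (λ x y → ι x ℕ.+ ι y ℕ.+ ι (isw v ∧ (count S′ ≡ᵇ j))) (layer-BS-w j) (layer-B′S′-w j) ⟩
        ι (isw v ∧ (count S′ ≡ᵇ j))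
          ≡⟨ cong (λ b → ι (b ∧ (count S′ ≡ᵇ j))) isw-w ⟩
        ι (count S′ ≡ᵇ j)
          ≡⟨ cong₂ (λ x y → ι x ℕ.+ ι y) (previous-cong layer-B′S′-w j ∙ previous-false j) (layer-BS′-w j) ⟨
        ι (previous (λ i → layer B′ S′ i v) j) ℕ.+ ι (layer B S′ j v)
          ∎
      at v (no v≢w) = begin
        ι (layer B S j v) ℕ.+ ι (layer B′ S′ j v) ℕ.+ ι (isw v ∧ (count S′ ≡ᵇ j))
          ≡⟨ cong₂ (λ x y → ι x ℕ.+ ι y ℕ.+ ι (isw v ∧ (count S′ ≡ᵇ j))) (layer-BS-≢ v≢w j) (layer-B′S′-≢ v≢w j) ⟩
        ι (L ∧ (not (S′ v) ∧ ((ι e ℕ.+ z) ≡ᵇ j))) ℕ.+ ι ((L ∧ e) ∧ (not (S′ v) ∧ (z ≡ᵇ j))) ℕ.+ ι (isw v ∧ (count S′ ≡ᵇ j))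
          ≡⟨ cong (λ b → rest ℕ.+ ι (b ∧ (count S′ ≡ᵇ j))) (dec-false (v ≟ w) v≢w) ⟩
        ι (L ∧ (not (S′ v) ∧ ((ι e ℕ.+ z) ≡ᵇ j))) ℕ.+ ι ((L ∧ e) ∧ (not (S′ v) ∧ (z ≡ᵇ j))) ℕ.+ 0
          ≡⟨ layer-identity L (S′ v) e z j ⟩
        ι (previous (λ i → (L ∧ e) ∧ (not (S′ v) ∧ (z ≡ᵇ i))) j) ℕ.+ ι (layer B S′ j v)
          ≡⟨ cong (λ b → ι b ℕ.+ ι (layer B S′ j v)) (previous-cong (layer-B′S′-≢ v≢w) j) ⟨
        ι (previous (λ i → layer B′ S′ i v) j) ℕ.+ ι (layer B S′ j v)
          ∎
          where L = lk B v
                e = E v w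
                z = deg S′ v
                rest = ι (L ∧ (not (S′ v) ∧ ((ι e ℕ.+ z) ≡ᵇ j))) ℕ.+ ι ((L ∧ e) ∧ (not (S′ v) ∧ (z ≡ᵇ j)))

    layer-sum : ∀ j → count (layer B S j) ℕ.+ count (layer B′ S′ j) ℕ.+ ι (count S′ ≡ᵇ j)
                      ≡ count (λ v → previous (λ i → layer B′ S′ i v) j) ℕ.+ count (layer B S′ j)
    layer-sum j = begin
      count (layer B S j) ℕ.+ count (layer B′ S′ j) ℕ.+ ι (count S′ ≡ᵇ j)
        ≡⟨ cong (count (layer B S j) ℕ.+ count (layer B′ S′ j) ℕ.+_) (count-point w (count S′ ≡ᵇ j)) ⟨
      count (layer B S j) ℕ.+ count (layer B′ S′ j) ℕ.+ count (λ v → isw v ∧ (count S′ ≡ᵇ j))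
        ≡⟨ cong (ℕ._+ count (λ v → isw v ∧ (count S′ ≡ᵇ j))) (ℕΣ.∑-distrib-+ (ι ∘ layer B S j) (ι ∘ layer B′ S′ j)) ⟨
      ℕΣ.sum (λ v → ι (layer B S j v) ℕ.+ ι (layer B′ S′ j v)) ℕ.+ count (λ v → isw v ∧ (count S′ ≡ᵇ j))
        ≡⟨ ℕΣ.∑-distrib-+ (λ v → ι (layer B S j v) ℕ.+ ι (layer B′ S′ j v)) (λ v → ι (isw v ∧ (count S′ ≡ᵇ j))) ⟨
      ℕΣ.sum (λ v → ι (layer B S j v) ℕ.+ ι (layer B′ S′ j v) ℕ.+ ι (isw v ∧ (count S′ ≡ᵇ j)))
        ≡⟨ ℕΣ.sum-cong-≗ (layer-pointwise j) ⟩
      ℕΣ.sum (λ v → ι (previous (λ i → layer B′ S′ i v) j) ℕ.+ ι (layer B S′ j v))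
        ≡⟨ ℕΣ.∑-distrib-+ (λ v → ι (previous (λ i → layer B′ S′ i v) j)) (ι ∘ layer B S′ j) ⟩
      count (λ v → previous (λ i → layer B′ S′ i v) j) ℕ.+ count (layer B S′ j)
        ∎
      where open ≡-Reasoning

  layerCount-suc : ∀ m → LayerCount m → LayerCount (suc m)
  layerCount-suc m IH B S count-S≡ clique disjoint j with count-suc S count-S≡
  ... | w , Sw = peeled j
    where
    open Peel B S w Sw clique disjoint
    β = count B
    count-S′ : count S′ ≡ m
    count-S′ = ℕP.suc-injective (sym count-S ∙ count-S≡)
    IH-B : ∀ i → + count (layer B S′ i) ≡ F β m i
    IH-B = IH B S′ count-S′ BS′-clique BS′-disjoint
    IH-B′ : ∀ i → + count (layer B′ S′ i) ≡ F (suc β) m i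
    IH-B′ i = IH B′ S′ count-S′ B′S′-clique B′S′-disjoint i ∙ cong (λ c → F c m i) count-B′
    in-ℤ : ∀ j → + count (layer B S j)
                 ≡ + count (λ v → previous (λ i → layer B′ S′ i v) j) + + count (layer B S′ j) - + count (layer B′ S′ j) - + ι (m ≡ᵇ j)
    in-ℤ j = ℕ-identity⇒ℤ _ _ (ι (count S′ ≡ᵇ j)) prev (count (layer B S′ j)) (layer-sum j) ∙
                   cong (λ k → + prev + + count (layer B S′ j) - + count (layer B′ S′ j) - + ι (k ≡ᵇ j)) count-S′
      where prev = count (λ v → previous (λ i → layer B′ S′ i v) j)
    peeled : ∀ j → + count (layer B S j) ≡ F β (suc m) j
    peeled zero = begin
      + count (layer B S 0)                                                        ≡⟨ in-ℤ 0 ⟩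
      + count {n} (λ _ → false) + + count (layer B S′ 0) - + count (layer B′ S′ 0) - + ι (m ≡ᵇ 0)
        ≡⟨ cong₂ (λ x y → x - y - + ι (m ≡ᵇ 0)) (cong₂ _+_ (cong +_ (count-∅ n)) (IH-B 0)) (IH-B′ 0) ⟩
      + 0 + F β m 0 - F (suc β) m 0 - + ι (m ≡ᵇ 0)                                 ≡⟨ cong (λ x → x - F (suc β) m 0 - + ι (m ≡ᵇ 0)) (ℤP.+-identityˡ (F β m 0)) ⟩
      F β (suc m) 0                                                                ∎
      where open ≡-Reasoning
    peeled (suc j) = in-ℤ (suc j) ∙
      cong₂ (λ x y → x - y - + ι (m ≡ᵇ suc j)) (cong₂ _+_ (IH-B′ j) (IH-B (suc j))) (IH-B′ (suc j))

  layerCount : ∀ m → LayerCount m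
  layerCount zero = layerCount-zero
  layerCount (suc m) = layerCount-suc m (layerCount m)

-- Accepted words and ordered cliques

δ*-nothing : ∀ {n l} (E : Adj n) (x : Vec (Fin n) l) → δ* E nothing x ≡ nothing
δ*-nothing E Vec.[] = refl
δ*-nothing E (v Vec.∷ x) = δ*-nothing E x

module Walks {n : ℕ} (E : Adj n) (E-sym : ∀ u v → E u v ≡ E v u) (E-irrefl : ∀ v → E v v ≡ false)
             (ℓ : ℕ → ℕ) (regular : ∀ σ → IsClique E σ → ∣ Lk E σ ∣ ≡ ℓ ∣ σ ∣) where

  open Cliques E E-sym
  open Coefficients ℓ
  open Layers E E-sym ℓ regular

  -- Φ l m is the number of accepted words of length l from any clique of size m (Δ≡Φ).
  Φ : ℕ → ℕ → ℤ
  Φ zero m = + 1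
  Φ (suc l) m = ∑ (λ j → F 0 m j * Φ l (suc j)) (upTo (suc m))

  step : Subset n → Fin n → Subset n
  step σ v = (nbr E v ∩ σ) ∪ ⁅ v ⁆

  Δ-suc : ∀ σ l → Δ E σ (suc l) ≡ ∑ (λ v → if lookup σ v then + 0 else Δ E (step σ v) l) (allFin n)
  Δ-suc σ l = begin
    Δ E σ (suc l)
      ≡⟨ +length-filter accepted (List.concatMap (λ v → List.map (v Vec.∷_) (words l)) (allFin n)) ⟩
    ∑ (λ x → + ι (accepted x)) (List.concatMap (λ v → List.map (v Vec.∷_) (words l)) (allFin n))
      ≡⟨ ∑-concatMap (λ x → + ι (accepted x)) (λ v → List.map (v Vec.∷_) (words l)) (allFin n) ⟩
    ∑ (λ v → ∑ (λ x → + ι (accepted x)) (List.map (v Vec.∷_) (words l))) (allFin n)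
      ≡⟨ ∑-cong (allFin n) (λ v → ∑-map (λ x → + ι (accepted x)) (v Vec.∷_) (words l) ∙ first-letter v (lookup σ v) refl) ⟩
    ∑ (λ v → if lookup σ v then + 0 else Δ E (step σ v) l) (allFin n)
      ∎
    where
    open ≡-Reasoning
    accepted : ∀ {k} → Vec (Fin n) k → Bool
    accepted x = is-just (δ* E (just σ) x)
    first-letter : ∀ v b → lookup σ v ≡ b
      → ∑ (λ x → + ι (accepted (v Vec.∷ x))) (words l) ≡ (if b then + 0 else Δ E (step σ v) l)
    first-letter v true σv = ∑-zero (words l) (λ x →
      cong (λ b → + ι (is-just (δ* E (if b then nothing else just (step σ v)) x))) σv ∙ cong (+_ ∘ ι ∘ is-just) (δ*-nothing E x))
    first-letter v false σv = ∑-cong (words l) (λ x → cong (λ b → + ι (is-just (δ* E (if b then nothing else just (step σ v)) x))) σv)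
                            ∙ sym (+length-filter (λ x → is-just (δ* E (just (step σ v)) x)) (words l))

  lookup-step : ∀ σ v u → lookup (step σ v) u ≡ (E v u ∧ lookup σ u) ∨ does (u ≟ v)
  lookup-step σ v u = lookup-∪ (nbr E v ∩ σ) ⁅ v ⁆ u
    ∙ cong₂ _∨_ (lookup-∩ (nbr E v) σ u ∙ cong (_∧ lookup σ u) (lookup∘tabulate (E v) u)) (lookup-⁅⁆ v u)

  step-clique : ∀ σ v → IsCliqueᵖ (lookup σ) → IsCliqueᵖ (lookup (step σ v))
  step-clique σ v c u w σ′u σ′w u≢w
    with ∨-true (E v u ∧ lookup σ u) (sym (lookup-step σ v u) ∙ σ′u) | ∨-true (E v w ∧ lookup σ w) (sym (lookup-step σ v w) ∙ σ′w)
  ... | inj₁ vu | inj₁ vw = c u w (proj₂ (∧-true vu)) (proj₂ (∧-true vw)) u≢w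
  ... | inj₁ vu | inj₂ w≡v = cong (E u) (does-≟-true w≡v) ∙ E-sym u v ∙ proj₁ (∧-true vu)
  ... | inj₂ u≡v | inj₁ vw = cong (λ x → E x w) (does-≟-true u≡v) ∙ proj₁ (∧-true vw)
  ... | inj₂ u≡v | inj₂ w≡v = ⊥-elim (u≢w (does-≟-true u≡v ∙ sym (does-≟-true w≡v)))

  ∣step∣ : ∀ σ v → ∣ step σ v ∣ ≡ suc (deg (lookup σ) v)
  ∣step∣ σ v = ∣∣≡count (step σ v) ∙ count-split-point v (lookup (step σ v))
    ∙ cong₂ ℕ._+_ (cong ι (lookup-step σ v v ∙ cong ((E v v ∧ lookup σ v) ∨_) (dec-true (v ≟ v) refl) ∙ ∨-zeroʳ _))
                  (count-cong off-v)
    where off-v : ∀ u → lookup (step σ v) u ∧ not (does (u ≟ v)) ≡ E v u ∧ lookup σ u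
          off-v u with u ≟ v
          ... | yes refl = cong (_∧ false) (lookup-step σ u u) ∙ ∧-zeroʳ _ ∙ sym (cong (_∧ lookup σ u) (E-irrefl u))
          ... | no u≢v = ∧-identityʳ _ ∙ lookup-step σ v u ∙ cong ((E v u ∧ lookup σ u) ∨_) (dec-false (u ≟ v) u≢v) ∙ ∨-identityʳ _

  deg≤∣∣ : ∀ σ v → deg (lookup σ) v ≤ ∣ σ ∣
  deg≤∣∣ σ v = ℕP.≤-trans (count-mono _ (lookup σ) (λ u e → proj₂ (∧-true e))) (ℕP.≤-reflexive (sym (∣∣≡count σ)))

  lk-∅ : ∀ v → lk (λ _ → false) v ≡ true
  lk-∅ v = lk⇐ (λ _ → false) (λ _ _ ()) v refl (λ _ ())

  Δ≡Φ : ∀ l σ → IsCliqueᵖ (lookup σ) → Δ E σ l ≡ Φ l ∣ σ ∣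
  Δ≡Φ zero σ c = refl
  Δ≡Φ (suc l) σ c = begin
    Δ E σ (suc l)
      ≡⟨ Δ-suc σ l ⟩
    ∑ (λ v → if lookup σ v then + 0 else Δ E (step σ v) l) (allFin n)
      ≡⟨ ∑-cong (allFin n) (λ v → after-step v (lookup σ v)) ⟩
    ∑ (λ v → if lookup σ v then + 0 else Φ l (suc (deg (lookup σ) v))) (allFin n)
      ≡⟨ ∑-levels (lookup σ) (deg (lookup σ)) (Φ l ∘ suc) ∣ σ ∣ (deg≤∣∣ σ) ⟩
    ∑ (λ j → + count (λ v → not (lookup σ v) ∧ (deg (lookup σ) v ≡ᵇ j)) * Φ l (suc j)) (upTo (suc ∣ σ ∣))
      ≡⟨ ∑-cong (upTo (suc ∣ σ ∣)) (λ j → cong (_* Φ l (suc j)) (layer-count j)) ⟩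
    ∑ (λ j → F 0 ∣ σ ∣ j * Φ l (suc j)) (upTo (suc ∣ σ ∣))
      ∎
    where
    open ≡-Reasoning
    after-step : ∀ v b → (if b then + 0 else Δ E (step σ v) l) ≡ (if b then + 0 else Φ l (suc (deg (lookup σ) v)))
    after-step v true = refl
    after-step v false = Δ≡Φ l (step σ v) (step-clique σ v c) ∙ cong (Φ l) (∣step∣ σ v)
    layer-count : ∀ j → + count (λ v → not (lookup σ v) ∧ (deg (lookup σ) v ≡ᵇ j)) ≡ F 0 ∣ σ ∣ j
    layer-count j = cong +_ (count-cong (λ v → cong (_∧ (not (lookup σ v) ∧ (deg (lookup σ) v ≡ᵇ j))) (sym (lk-∅ v))))
      ∙ layerCount ∣ σ ∣ (λ _ → false) (lookup σ) (sym (∣∣≡count σ)) c (λ _ ()) j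
      ∙ cong (λ b → F b ∣ σ ∣ j) (count-∅ n)

  IsOrdClique : ∀ {m} → Vec (Fin n) m → Set
  IsOrdClique {m} t = ∀ (i j : Fin m) → i ≢ j → lookup t i ≢ lookup t j × E (lookup t i) (lookup t j) ≡ true

  isOrdClique⇒ : ∀ {m} (t : Vec (Fin n) m) → isOrdCliqueᵇ E t ≡ true → IsOrdClique t
  isOrdClique⇒ t e i j i≢j with allᵇ-tabulate⇒ _ (λ x → x) (allᵇ-tabulate⇒ _ (λ x → x) e i) j
  ... | h rewrite dec-false (i ≟ j) i≢j with ∧-true h
  ...   | ti≠tj , adj = (λ ti≡tj → true≢false (sym ti≠tj ∙ cong not (dec-true (lookup t i ≟ lookup t j) ti≡tj))) , adj

  isOrdClique⇐ : ∀ {m} (t : Vec (Fin n) m) → IsOrdClique t → isOrdCliqueᵇ E t ≡ true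
  isOrdClique⇐ t o = allᵇ-tabulate⇐ _ (λ x → x) (λ i → allᵇ-tabulate⇐ _ (λ x → x) (λ j → pair i j))
    where
    pair : ∀ i j → not (i ≠ᵇ j) ∨ ((lookup t i ≠ᵇ lookup t j) ∧ E (lookup t i) (lookup t j)) ≡ true
    pair i j with i ≟ j
    ... | yes _ = refl
    ... | no i≢j rewrite dec-false (lookup t i ≟ lookup t j) (proj₁ (o i j i≢j)) = proj₂ (o i j i≢j)

  lookup-toSet-∷ : ∀ {m} v (t : Vec (Fin n) m) u → lookup (toSet (v Vec.∷ t)) u ≡ does (u ≟ v) ∨ lookup (toSet t) u
  lookup-toSet-∷ v t u = lookup-∪ ⁅ v ⁆ (toSet t) u ∙ cong (_∨ lookup (toSet t) u) (lookup-⁅⁆ v u)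

  toSet⇒ : ∀ {m} (t : Vec (Fin n) m) u → lookup (toSet t) u ≡ true → Σ (Fin m) λ i → lookup t i ≡ u
  toSet⇒ Vec.[] u e = ⊥-elim (true≢false (sym e ∙ lookup-⊥ u))
  toSet⇒ (v Vec.∷ t) u e with ∨-true (does (u ≟ v)) (sym (lookup-toSet-∷ v t u) ∙ e)
  ... | inj₁ u≡v = Fin.zero , sym (does-≟-true u≡v)
  ... | inj₂ u∈t with toSet⇒ t u u∈t
  ...   | i , tᵢ≡u = Fin.suc i , tᵢ≡u

  toSet⇐ : ∀ {m} (t : Vec (Fin n) m) i → lookup (toSet t) (lookup t i) ≡ true
  toSet⇐ (v Vec.∷ t) Fin.zero = lookup-toSet-∷ v t v ∙ cong (_∨ lookup (toSet t) v) (dec-true (v ≟ v) refl)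
  toSet⇐ (v Vec.∷ t) (Fin.suc i) = lookup-toSet-∷ v t (lookup t i) ∙ cong (does (lookup t i ≟ v) ∨_) (toSet⇐ t i) ∙ ∨-zeroʳ _

  ordClique-clique : ∀ {m} (t : Vec (Fin n) m) → IsOrdClique t → IsCliqueᵖ (lookup (toSet t))
  ordClique-clique t o u w tu tw u≢w with toSet⇒ t u tu | toSet⇒ t w tw
  ... | i , refl | j , refl = proj₂ (o i j (λ i≡j → u≢w (cong (lookup t) i≡j)))

  ordClique-∷⇒ : ∀ {m} v (t : Vec (Fin n) m) → IsOrdClique (v Vec.∷ t) → IsOrdClique t × lookup (toSet t) v ≡ false
  ordClique-∷⇒ v t o = (λ i j i≢j → o (Fin.suc i) (Fin.suc j) (λ { refl → i≢j refl })) , v∉t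
    where v∉t : lookup (toSet t) v ≡ false
          v∉t with lookup (toSet t) v in v∈t
          ... | false = refl
          ... | true with toSet⇒ t v v∈t
          ...   | i , tᵢ≡v = ⊥-elim (proj₁ (o Fin.zero (Fin.suc i) (λ ())) (sym tᵢ≡v))

  ordClique-count : ∀ {m} (t : Vec (Fin n) m) → IsOrdClique t → count (lookup (toSet t)) ≡ m
  ordClique-count Vec.[] _ = count-false (lookup (⊥ {n})) lookup-⊥
  ordClique-count (v Vec.∷ t) o = count-split-point v (lookup (toSet (v Vec.∷ t)))
    ∙ cong₂ ℕ._+_ (cong ι (lookup-toSet-∷ v t v ∙ cong (_∨ lookup (toSet t) v) (dec-true (v ≟ v) refl))) (count-cong off-v ∙ ordClique-count t (proj₁ tail))
    where
    tail = ordClique-∷⇒ v t o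
    off-v : ∀ u → lookup (toSet (v Vec.∷ t)) u ∧ not (does (u ≟ v)) ≡ lookup (toSet t) u
    off-v u with u ≟ v
    ... | yes refl = cong (_∧ false) (lookup-toSet-∷ u t u) ∙ ∧-zeroʳ _ ∙ sym (proj₂ tail)
    ... | no u≢v = ∧-identityʳ _ ∙ lookup-toSet-∷ v t u ∙ cong (_∨ lookup (toSet t) u) (dec-false (u ≟ v) u≢v)

  lookup-Lk : ∀ σ v → lookup (Lk E σ) v ≡ lk (lookup σ) v
  lookup-Lk σ v = cong (λ τ → lookup (Lk E τ) v) (sym (tabulate∘lookup σ))

  isOrdClique-∷ : ∀ {m} v (t : Vec (Fin n) m) → isOrdCliqueᵇ E (v Vec.∷ t) ≡ isOrdCliqueᵇ E t ∧ lookup (Lk E (toSet t)) v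
  isOrdClique-∷ v t = bool-ext to from
    where
    to : isOrdCliqueᵇ E (v Vec.∷ t) ≡ true → isOrdCliqueᵇ E t ∧ lookup (Lk E (toSet t)) v ≡ true
    to e = cong₂ _∧_ (isOrdClique⇐ t (proj₁ tail))
                     (lookup-Lk (toSet t) v ∙ lk⇐ (lookup (toSet t)) (ordClique-clique t (proj₁ tail)) v (proj₂ tail) adjacent)
      where
      o = isOrdClique⇒ (v Vec.∷ t) e
      tail = ordClique-∷⇒ v t o
      adjacent : ∀ u → lookup (toSet t) u ≡ true → E u v ≡ true
      adjacent u u∈t with toSet⇒ t u u∈t
      ... | i , refl = proj₂ (o (Fin.suc i) Fin.zero (λ ()))
    from : isOrdCliqueᵇ E t ∧ lookup (Lk E (toSet t)) v ≡ true → isOrdCliqueᵇ E (v Vec.∷ t) ≡ true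
    from e = isOrdClique⇐ (v Vec.∷ t) ordered
      where
      parts = ∧-true e
      ot = isOrdClique⇒ t (proj₁ parts)
      link = lk⇒ (lookup (toSet t)) v (sym (lookup-Lk (toSet t) v) ∙ proj₂ parts)
      head : ∀ i → lookup t i ≢ v × E (lookup t i) v ≡ true
      head i = (λ tᵢ≡v → true≢false (sym (toSet⇐ t i) ∙ cong (lookup (toSet t)) tᵢ≡v ∙ proj₁ link))
             , proj₂ link (lookup t i) (toSet⇐ t i)
      ordered : IsOrdClique (v Vec.∷ t)
      ordered Fin.zero Fin.zero i≢j = ⊥-elim (i≢j refl)
      ordered Fin.zero (Fin.suc j) _ = (λ v≡tⱼ → proj₁ (head j) (sym v≡tⱼ)) , E-sym v (lookup t j) ∙ proj₂ (head j)
      ordered (Fin.suc i) Fin.zero _ = head i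
      ordered (Fin.suc i) (Fin.suc j) i≢j = ot i j (λ i≡j → i≢j (cong Fin.suc i≡j))

  #ordCliques : ℕ → ℕ
  #ordCliques m = length (filterᵇ (isOrdCliqueᵇ E) (words {n} m))

  ∣toSet∣ : ∀ {m} (t : Vec (Fin n) m) → IsOrdClique t → ∣ toSet t ∣ ≡ m
  ∣toSet∣ t o = ∣∣≡count (toSet t) ∙ ordClique-count t o

  ordClique-isClique : ∀ {m} (t : Vec (Fin n) m) → IsOrdClique t → IsClique E (toSet t)
  ordClique-isClique t o = isClique⇐ (toSet t) (ordClique-clique t o)

  #ordCliques-suc : ∀ m → + #ordCliques (suc m) ≡ + #ordCliques m * + ℓ m
  #ordCliques-suc m = begin
    + #ordCliques (suc m)
      ≡⟨ +length-filter (isOrdCliqueᵇ E) (List.concatMap (λ v → List.map (v Vec.∷_) (words m)) (allFin n)) ⟩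
    ∑ (λ x → + ι (isOrdCliqueᵇ E x)) (List.concatMap (λ v → List.map (v Vec.∷_) (words m)) (allFin n))
      ≡⟨ ∑-concatMap (λ x → + ι (isOrdCliqueᵇ E x)) (λ v → List.map (v Vec.∷_) (words m)) (allFin n) ⟩
    ∑ (λ v → ∑ (λ x → + ι (isOrdCliqueᵇ E x)) (List.map (v Vec.∷_) (words m))) (allFin n)
      ≡⟨ ∑-cong (allFin n) (λ v → ∑-map (λ x → + ι (isOrdCliqueᵇ E x)) (v Vec.∷_) (words m)
                                  ∙ ∑-cong (words m) (λ t → cong (+_ ∘ ι) (isOrdClique-∷ v t))) ⟩
    ∑ (λ v → ∑ (λ t → extends t v) (words m)) (allFin n)
      ≡⟨ ∑-swap (λ v t → extends t v) (allFin n) (words m) ⟩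
    ∑ (λ t → ∑ (extends t) (allFin n)) (words m)
      ≡⟨ ∑-cong (words m) (λ t → extensions t (isOrdCliqueᵇ E t) refl) ⟩
    ∑ (λ t → if isOrdCliqueᵇ E t then + ℓ m else + 0) (words m)
      ≡⟨ ∑-if (isOrdCliqueᵇ E) (words m) ⟩
    + #ordCliques m * + ℓ m
      ∎
    where
    open ≡-Reasoning
    extends : Vec (Fin n) m → Fin n → ℤ
    extends t v = + ι (isOrdCliqueᵇ E t ∧ lookup (Lk E (toSet t)) v)
    extensions : ∀ t b → isOrdCliqueᵇ E t ≡ b → ∑ (extends t) (allFin n) ≡ (if b then + ℓ m else + 0)
    extensions t false e = ∑-zero (allFin n) (λ v → cong (λ b → + ι (b ∧ lookup (Lk E (toSet t)) v)) e)
    extensions t true e = begin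
      ∑ (extends t) (allFin n)                            ≡⟨ ∑-cong (allFin n) (λ v → cong (λ b → + ι (b ∧ lookup (Lk E (toSet t)) v)) e) ⟩
      ∑ (λ v → + ι (lookup (Lk E (toSet t)) v)) (allFin n) ≡⟨ ∑-ι-allFin (lookup (Lk E (toSet t))) ⟩
      + count (lookup (Lk E (toSet t)))                    ≡⟨ cong +_ (∣∣≡count (Lk E (toSet t))) ⟨
      + ∣ Lk E (toSet t) ∣                                 ≡⟨ cong +_ (regular (toSet t) (ordClique-isClique t o) ∙ cong ℓ (∣toSet∣ t o)) ⟩
      + ℓ m                                               ∎
      where o = isOrdClique⇒ t e

  #ordCliques≡a : ∀ m → + #ordCliques m ≡ a ℓ m
  #ordCliques≡a zero = refl
  #ordCliques≡a (suc m) = #ordCliques-suc m ∙ cong (_* + ℓ m) (#ordCliques≡a m)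

  #ordCliques-beyond : ∀ d → (∀ σ → IsClique E σ → ∣ σ ∣ ≤ d) → #ordCliques (suc d) ≡ 0
  #ordCliques-beyond d bounded = ℤP.+-injective (+length-filter (isOrdCliqueᵇ E) (words (suc d)) ∙ ∑-zero (words (suc d)) none)
    where
    none : ∀ t → + ι (isOrdCliqueᵇ E t) ≡ + 0
    none t with isOrdCliqueᵇ E t in e
    ... | false = refl
    ... | true = ⊥-elim (ℕP.<-irrefl refl (ℕP.≤-trans (ℕP.≤-reflexive (sym (∣toSet∣ t o))) (bounded (toSet t) (ordClique-isClique t o))))
      where o = isOrdClique⇒ t e

  𝒢-value : ∀ m l → 𝒢 E m l ≡ a ℓ m * Φ l m
  𝒢-value m l = sumˢ-map (λ t → Δ E (toSet t)) (filterᵇ (isOrdCliqueᵇ E) (words m)) l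
    ∙ ∑-filter-const (isOrdCliqueᵇ E) (words m) (λ t e → let o = isOrdClique⇒ t e in Δ≡Φ l (toSet t) (ordClique-clique t o) ∙ cong (Φ l) (∣toSet∣ t o))
    ∙ cong (_* Φ l m) (#ordCliques≡a m)

  𝒢₀-value : ∀ l → 𝒢₀ E l ≡ Φ l 0
  𝒢₀-value l = Δ≡Φ l ⊥ (λ u _ u∈⊥ → ⊥-elim (true≢false (sym u∈⊥ ∙ lookup-⊥ u))) ∙ cong (Φ l) (∣⊥∣≡0 n)

  a*Φ-suc : ∀ m l → a ℓ m * Φ (suc l) m ≡ ∑ (λ k → b ℓ m k * (a ℓ (suc k) * Φ l (suc k))) (upTo m) + a ℓ (suc m) * Φ l (suc m)
  a*Φ-suc m l = begin
    a ℓ m * Φ (suc l) m                                             ≡⟨ ∑-*ˡ (a ℓ m) (λ j → F 0 m j * Φ l (suc j)) (upTo (suc m)) ⟨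
    ∑ term (upTo (suc m))                                           ≡⟨ ∑-upTo-suc term m ⟩
    ∑ term (upTo m) + term m                                        ≡⟨ cong₂ _+_ (∑-upTo-cong m below) (reassoc (a ℓ m) (F 0 m m) (Φ l (suc m)) ∙ cong (_* Φ l (suc m)) (a*F-diagonal m)) ⟩
    ∑ (λ k → b ℓ m k * (a ℓ (suc k) * Φ l (suc k))) (upTo m) + a ℓ (suc m) * Φ l (suc m)
      ∎
    where
    open ≡-Reasoning
    term = λ j → a ℓ m * (F 0 m j * Φ l (suc j))
    reassoc : ∀ x y z → x * (y * z) ≡ x * y * z
    reassoc x y z = sym (ℤP.*-assoc x y z)
    below : ∀ k → k < m → term k ≡ b ℓ m k * (a ℓ (suc k) * Φ l (suc k))
    below k k<m = reassoc (a ℓ m) (F 0 m k) (Φ l (suc k)) ∙ cong (_* Φ l (suc k)) (a*F≡b*a m k k<m) ∙ ℤP.*-assoc (b ℓ m k) _ _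

  module _ (d : ℕ) (bounded : ∀ σ → IsClique E σ → ∣ σ ∣ ≤ d) where

    open ClosedForm ℓ (𝒢₀ E) (𝒢ᵈ E d)

    𝒢ᵈ-value : ∀ k → k ≤ d → ∀ l → 𝒢ᵈ E d (suc k) l ≡ a ℓ (suc k) * Φ l (suc k)
    𝒢ᵈ-value k k≤d l with ℕP.m≤n⇒m<n∨m≡n k≤d
    ... | inj₁ k<d = cong (λ b → (if b then 𝒢 E (suc k) else 0ˢ) l) (dec-true (suc k ℕP.≤? d) k<d) ∙ 𝒢-value (suc k) l
    ... | inj₂ refl = cong (λ b → (if b then 𝒢 E (suc k) else 0ˢ) l) (dec-false (suc k ℕP.≤? k) (ℕP.<-irrefl refl))
                    ∙ sym (cong (_* Φ l (suc k)) (sym (#ordCliques≡a (suc k)) ∙ cong +_ (#ordCliques-beyond k bounded)))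

    G′-value : ∀ m → m ≤ d → ∀ l → G′ m l ≡ a ℓ m * Φ l m
    G′-value zero _ l = 𝒢₀-value l ∙ sym (ℤP.*-identityˡ (Φ l 0))
    G′-value (suc m) m<d = 𝒢ᵈ-value m (ℕP.<⇒≤ m<d)

    𝒢ᵈ-recurrence : ∀ m → m ≤ d → Recurrence m
    𝒢ᵈ-recurrence m m≤d zero = sym (begin
      G′ m 0 - a ℓ m * + 1 - W 0                  ≡⟨ cong₂ (λ x y → x - a ℓ m * + 1 - y) (G′-value m m≤d 0) (∑ˢ-at (b ℓ m) m shifted 0 ∙ ∑-zero (upTo m) (λ k → ℤP.*-zeroʳ (b ℓ m k))) ⟩
      a ℓ m * + 1 - a ℓ m * + 1 - + 0            ≡⟨ lemma (a ℓ m * + 1) ⟩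
      + 0                                         ∎)
      where
      open ≡-Reasoning
      shifted = λ k → shift 1 (𝒢ᵈ E d (suc k))
      W = ∑ˢ (b ℓ m) m shifted
      lemma : ∀ x → x - x - + 0 ≡ + 0
      lemma = solve-∀
    𝒢ᵈ-recurrence m m≤d (suc l) = sym (begin
      G′ m (suc l) - a ℓ m * + 0 - W (suc l)          ≡⟨ cong₂ (λ x y → x - a ℓ m * + 0 - y) (G′-value m m≤d (suc l) ∙ a*Φ-suc m l) (∑ˢ-at (b ℓ m) m shifted (suc l)) ⟩
      ∑ bΦ (upTo m) + a ℓ (suc m) * Φ l (suc m) - a ℓ m * + 0 - ∑ b𝒢 (upTo m)
                                                      ≡⟨ cong₂ (λ x y → x + y - a ℓ m * + 0 - ∑ b𝒢 (upTo m)) (∑-upTo-cong m (λ k k<m → cong (b ℓ m k *_) (sym (𝒢ᵈ-value k (ℕP.≤-trans (ℕP.<⇒≤ k<m) m≤d) l)))) (sym (𝒢ᵈ-value m m≤d l)) ⟩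
      ∑ b𝒢 (upTo m) + 𝒢ᵈ E d (suc m) l - a ℓ m * + 0 - ∑ b𝒢 (upTo m)
                                                      ≡⟨ lemma (∑ b𝒢 (upTo m)) (𝒢ᵈ E d (suc m) l) (a ℓ m) ⟩
      𝒢ᵈ E d (suc m) l                                ∎)
      where
      open ≡-Reasoning
      shifted = λ k → shift 1 (𝒢ᵈ E d (suc k))
      W = ∑ˢ (b ℓ m) m shifted
      bΦ = λ k → b ℓ m k * (a ℓ (suc k) * Φ l (suc k))
      b𝒢 = λ k → b ℓ m k * 𝒢ᵈ E d (suc k) l
      lemma : ∀ s g x → s + g - x * + 0 - s ≡ g
      lemma = solve-∀

lemma6p10 : (n : ℕ) (E : Adj n)
  → (∀ u v → E u v ≡ E v u)
  → (∀ v → E v v ≡ false)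
  → (d : ℕ)
  → Σ (Subset n) (λ σ → IsClique E σ × ∣ σ ∣ ≡ d)
  → (∀ σ → IsClique E σ → ∣ σ ∣ ≤ d)
  → (ℓ : ℕ → ℕ)
  → (∀ σ → IsClique E σ → ∣ Lk E σ ∣ ≡ ℓ ∣ σ ∣)
  → (m : ℕ) → 1 ≤ m → m ≤ suc d
  → shift m (𝒢ᵈ E d m) ≈ˢ (p ℓ m *ˢ 𝒢₀ E -ˢ q ℓ m)
lemma6p10 n E E-sym E-irrefl d _ bounded ℓ regular (suc j) _ (s≤s j≤d) =
  solved d (𝒢ᵈ-recurrence d bounded) j j≤d
  where
  open Walks E E-sym E-irrefl ℓ regular
  open ClosedForm ℓ (𝒢₀ E) (𝒢ᵈ E d)
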